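{- For every integer $k\ge0$, with the notation below, \[ \frac{d}{dx}\mathcal A_k(x)=\frac{2}{1-x}\mathcal A_k(x)+\frac{d}{dx}\mathcal B_k(x),\qquad \frac{d}{dx}\mathcal B_{>k}(x)=2\left(\frac1{1-x}-B_{\le k-1}(x)\right)\mathcal B_{>k-1}(x), \] where $B_{\le -1}(x):=0$ and $\mathcal B_{>-1}(x)=\frac{x-1}{3}+\frac{1}{3(1-x)^2}$ is the generating function $\sum_{n\ge1}\mathrm{E}[L_n]x^n$. Consequently \[ f_k=2\int_0^1(1-x)\,\mathcal B_k(x)\,dx . \]
   Context: For a permutation $p$ of $[n]$, the decreasing binary tree $T(p)$ has root labelled $n$, left subtree $T(p')$ and right subtree $T(p'')$ where $p',p''$ are the substrings of $p$ to the left and right of $n$ (an empty substring gives no child). The random tree $T_n$ is $T(p)$ for uniformly random $p$. The rank $R(v)$ of a vertex $v$ is the number of edges in a shortest path from $v$ to a descendant leaf of $v$ (a vertex counts as its own descendant). $L_n$ is the number of leaves of $T_n$. $F_{n,k}$ is the expected number of pairs $(v,u)$ in $T_n$ with $v$ of rank $k$ and $u$ a leaf descendant of $v$; $f_{n,k}=\mathrm{E}\bigl[\mathbf 1_{\{R(\mathrm{root})=k\}}L_n\bigr]$ and $f_{n,>k}=\sum_{j>k}f_{n,j}$. Set $\mathcal A_k(x)=\sum_{n\ge1}F_{n,k}x^n$, $\mathcal B_k(x)=\sum_{n\ge1}f_{n,k}x^n$, $\mathcal B_{>k}(x)=\sum_{n\ge1}f_{n,>k}x^n$ (so $\mathcal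 B_k=\mathcal B_{>k-1}-\mathcal B_{>k}$), and $B_{\le t}(x)=\sum_{n\ge1}\mathrm{P}(R(\mathrm{root\ of\ }T_n)\le t)\,x^n$. For each $k$ the finite limit $f_k=\lim_{n\to\infty}F_{n,k}/n$ exists. -}

module Defs where

open import Data.Nat as ℕ using (ℕ; zero; suc; _⊓_; _⊔_; _≡ᵇ_; _<ᵇ_; _!)
open import Data.Nat.Properties using (_!≢0)
open import Data.Bool using (Bool; true; false; not; if_then_else_)
open import Data.List using (List; []; _∷_; map; concatMap; length; spanᵇ; drop; foldr; upTo)
open import Data.Product using (_,_)
open import Data.Integer using (+_)
open import Data.Rational as ℚ using (ℚ; _/_; _+_; _*_; _-_; 0ℚ)

insertions : ℕ → List ℕ → List (List ℕ)
insertions x []       = (x ∷ []) ∷ []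
insertions x (y ∷ ys) = (x ∷ y ∷ ys) ∷ map (y ∷_) (insertions x ys)

perms : ℕ → List (List ℕ)
perms zero    = [] ∷ []
perms (suc n) = concatMap (insertions (suc n)) (perms n)

data Tree : Set where
  nil  : Tree
  node : Tree → Tree → Tree

maxL : List ℕ → ℕ
maxL = foldr _⊔_ 0

-- Decreasing binary tree of a word of distinct numbers: root = maximum,
-- left subtree from the part left of it, right subtree from the part right of it.
-- The first argument is fuel (the length suffices).
build : ℕ → List ℕ → Tree
build zero    _  = nil
build (suc f) [] = nil
build (suc f) (x ∷ xs) with spanᵇ (λ y → not (y ≡ᵇ maxL (x ∷ xs))) (x ∷ xs)
... | (l , r) = node (build f l) (build f (drop 1 r))

T : List ℕ → Tree
T p = build (length p) p

-- rank of a vertex: distance to nearest descendant leaf (leaf = vertex without children)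
rank : Tree → ℕ
rank nil                = 0
rank (node nil nil)     = 0
rank (node l nil)       = suc (rank l)
rank (node nil r)       = suc (rank r)
rank (node l r)         = suc (rank l ⊓ rank r)

leaves : Tree → ℕ
leaves nil            = 0
leaves (node nil nil) = 1
leaves (node l r)     = leaves l ℕ.+ leaves r

-- number of pairs (v,u), v of rank k, u a leaf descendant of v
pairs : ℕ → Tree → ℕ
pairs k nil = 0
pairs k (node l r) =
  (if rank (node l r) ≡ᵇ k then leaves (node l r) else 0) ℕ.+ pairs k l ℕ.+ pairs k r

sumℕ : List ℕ → ℕ
sumℕ = foldr ℕ._+_ 0

E : ℕ → (Tree → ℕ) → ℚ
E n X = _/_ (+ sumℕ (map (λ p → X (T p)) (perms n))) (n !) {{n !≢0}}

indicator : Bool → ℕ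
indicator true  = 1
indicator false = 0

F : ℕ → ℕ → ℚ
F n k = E n (pairs k)

f : ℕ → ℕ → ℚ
f n k = E n (λ t → indicator (rank t ≡ᵇ k) ℕ.* leaves t)

-- fGe n k = f_{n,>k-1} = Σ_{j ≥ k} f_{n,j} = E[1{R(root) ≥ k} L_n]
-- (so fGe n 0 = f_{n,>-1} = E[L_n], and f_{n,>k} = fGe n (suc k))
fGe : ℕ → ℕ → ℚ
fGe n k = E n (λ t → indicator (not (rank t <ᵇ k)) ℕ.* leaves t)

-- pLt n k = P(R(root of T_n) ≤ k-1)   (= 0 for k = 0, matching B_{≤-1} = 0)
pLt : ℕ → ℕ → ℚ
pLt n k = E n (λ t → indicator (rank t <ᵇ k))

EL : ℕ → ℚ
EL n = E n leaves

sumℚ : List ℚ → ℚ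
sumℚ = foldr _+_ 0ℚ

Σ1 : ℕ → (ℕ → ℚ) → ℚ
Σ1 n g = sumℚ (map (λ i → g (suc i)) (upTo n))

ℕ→ℚ : ℕ → ℚ
ℕ→ℚ n = + n / 1

-- Inserting n + 1 at position i of a permutation p of [n] turns T(p) into a root whose two
-- subtrees are the pieces of T(p) cut after its i-th vertex in in-order. Averaging over i, and
-- by strong induction on n, cutting the tree of a uniform permutation of [n] at a uniform gap
-- yields two independent trees of uniform permutations, with sizes j + w = n and j uniform.
-- Hence the root of T_{n+1} splits it into independent copies of T_j and T_{n-j}, j uniform on
-- {0, …, n}, and decomposing pairs, leaves and rank indicators over the two subtrees gives the
-- coefficient recurrences.
-- For the limit, the first recurrence solves to F_{n+1,k} = 2(n+2) S_n + f_{n+1,k} with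
-- S_n = Σ_{m≤n} f_{m,k}/((m+1)(m+2)). The rank recurrence bounds P(R(root of T_m) < k) by
-- 4^k c_m, where c_m = C(2m,m)/4^m ≤ (2m+1)^{-1/2}; since c_m/(m+1) = 2(c_m - c_{m+1})
-- telescopes, S_n is Cauchy, while f_{n+1,k}/(n+1) and S_n/(n+1) are O(c_n).
module Submission where

open import Defs
open import Algebra.Bundles using (CommutativeMonoid)
open import Data.Bool using (Bool; true; false; not; _∨_; if_then_else_)
open import Data.Bool.Properties using (T-≡; ∨-zeroʳ)
open import Data.Empty using (⊥-elim)
open import Data.Integer as ℤ using (+_)
import Data.Integer.Properties as ℤP
open import Data.List using (List; []; _∷_; _++_; length; take; drop; spanᵇ; map; concatMap; applyUpTo)
open import Data.List.Relation.Unary.All using (All; []; _∷_)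
import Data.List.Relation.Unary.All as All
import Data.List.Relation.Unary.All.Properties as Allₚ
open import Data.Nat as ℕ
  using (ℕ; zero; suc; _∸_; _^_; _≤_; _<_; z≤n; s≤s; _≡ᵇ_; _≤ᵇ_; _<ᵇ_; _⊓_; _!; NonZero)
  renaming (_+_ to _+ℕ_; _*_ to _*ℕ_)
open import Data.Nat.Induction using (<-rec)
import Data.Nat.Properties as ℕP
open import Data.Nat.Tactic.RingSolver using (solve-∀)
open import Data.Product using (_×_; _,_; proj₁; proj₂; ∃-syntax; map₁; map₂)
open import Data.Rational as ℚ using (ℚ; _+_; _*_; _-_; -_; 0ℚ; 1ℚ; _/_; ∣_∣; fromℚᵘ)
  renaming (_≤_ to _≤ℚ_; _<_ to _<ℚ_)
import Data.Rational.Properties as ℚP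
open import Data.Rational.Solver using (module +-*-Solver)
open +-*-Solver using (solve; _:+_; _:*_; _:-_; :-_; _:=_; con)
open import Data.Rational.Unnormalised as ℚᵘ using (mkℚᵘ; *≡*)
import Data.Rational.Unnormalised.Properties as ℚᵘP
open import Data.Sum using (inj₁; inj₂)
open import Function using (Equivalence)
open import Relation.Binary.PropositionalEquality
open import Relation.Nullary using (¬_; yes; no; contradiction)

open import Algebra.Properties.CommutativeSemigroup
  (CommutativeMonoid.commutativeSemigroup ℚP.+-0-commutativeMonoid) using (interchange)

-- Decreasing trees of words

maxL-≤ : ∀ {m xs} → All (_≤ m) xs → maxL xs ≤ m
maxL-≤ []           = z≤n
maxL-≤ (x≤m ∷ xs≤m) = ℕP.⊔-lub x≤m (maxL-≤ xs≤m)

maxL-++-∷ : ∀ l m r → All (_< m) l → All (_≤ m) r → maxL (l ++ m ∷ r) ≡ m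
maxL-++-∷ []      m r []           r≤m = ℕP.m≥n⇒m⊔n≡m (maxL-≤ r≤m)
maxL-++-∷ (y ∷ l) m r (y<m ∷ l<m) r≤m
  rewrite maxL-++-∷ l m r l<m r≤m = ℕP.m≤n⇒m⊔n≡n (ℕP.<⇒≤ y<m)

≢max : ℕ → ℕ → Bool
≢max m y = not (y ≡ᵇ m)

≢max-< : ∀ {y m} → y < m → ≢max m y ≡ true
≢max-< {zero}  {suc m} _         = refl
≢max-< {suc y} {suc m} (s≤s y<m) = ≢max-< {y} {m} y<m

≢max-refl : ∀ m → ≢max m m ≡ false
≢max-refl zero    = refl
≢max-refl (suc m) = ≢max-refl m

spanᵇ-≢max : ∀ l m r → All (_< m) l → spanᵇ (≢max m) (l ++ m ∷ r) ≡ (l , m ∷ r)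
spanᵇ-≢max []      m r []          rewrite ≢max-refl m = refl
spanᵇ-≢max (y ∷ l) m r (y<m ∷ l<m)
  rewrite ≢max-< y<m | spanᵇ-≢max l m r l<m = refl

build-span : ∀ f x xs {l r} → spanᵇ (≢max (maxL (x ∷ xs))) (x ∷ xs) ≡ (l , r)
           → build (suc f) (x ∷ xs) ≡ node (build f l) (build f (drop 1 r))
build-span f x xs eq with spanᵇ (≢max (maxL (x ∷ xs))) (x ∷ xs) | eq
... | _ | refl = refl

span-at-max : ∀ l m r → All (_< m) l → All (_≤ m) r
            → spanᵇ (≢max (maxL (l ++ m ∷ r))) (l ++ m ∷ r) ≡ (l , m ∷ r)
span-at-max l m r l<m r≤m rewrite maxL-++-∷ l m r l<m r≤m = spanᵇ-≢max l m r l<m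

build-++-max : ∀ f l m r → All (_< m) l → All (_≤ m) r
             → build (suc f) (l ++ m ∷ r) ≡ node (build f l) (build f r)
build-++-max f []      m r l<m r≤m = build-span f m r (span-at-max [] m r l<m r≤m)
build-++-max f (y ∷ l) m r l<m r≤m = build-span f y (l ++ m ∷ r) (span-at-max (y ∷ l) m r l<m r≤m)

data MaxSplit : List ℕ → Set where
  empty  : MaxSplit []
  at-max : ∀ l m r → All (_< m) l → All (_≤ m) r → MaxSplit (l ++ m ∷ r)

maxSplit : ∀ q → MaxSplit q
maxSplit []       = empty
maxSplit (x ∷ xs) with maxSplit xs
... | empty                 = at-max [] x [] [] []
... | at-max l m r l<m r≤m with x ℕ.<? m
...   | yes x<m = at-max (x ∷ l) m r (x<m ∷ l<m) r≤m
...   | no  x≮m = at-max [] x (l ++ m ∷ r) []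
                    (Allₚ.++⁺ (All.map (λ y<m → ℕP.<⇒≤ (ℕP.<-≤-trans y<m m≤x)) l<m)
                              (m≤x ∷ All.map (λ y≤m → ℕP.≤-trans y≤m m≤x) r≤m))
  where m≤x = ℕP.≮⇒≥ x≮m

length-++-∷ : ∀ (l : List ℕ) m r → length (l ++ m ∷ r) ≡ suc (length l +ℕ length r)
length-++-∷ []      m r = refl
length-++-∷ (y ∷ l) m r = cong suc (length-++-∷ l m r)

length-parts : ∀ l m r {n} → length (l ++ m ∷ r) ≤ suc n → length l ≤ n × length r ≤ n
length-parts l m r h = ℕP.≤-trans (ℕP.m≤m+n _ _) |l|+|r|≤n , ℕP.≤-trans (ℕP.m≤n+m _ _) |l|+|r|≤n
  where |l|+|r|≤n = ℕ.s≤s⁻¹ (subst (_≤ _) (length-++-∷ l m r) h)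

length-++-∷≰0 : ∀ l m r → ¬ length (l ++ m ∷ r) ≤ 0
length-++-∷≰0 l m r h with () ← subst (_≤ 0) (length-++-∷ l m r) h

max-induction : (P : List ℕ → Set) → P [] →
  (∀ l m r → All (_< m) l → All (_≤ m) r → P l → P r → P (l ++ m ∷ r)) → ∀ q → P q
max-induction P P[] P-max q = go (length q) q ℕP.≤-refl
  where
  go : ∀ n q → length q ≤ n → P q
  go n q |q|≤n with maxSplit q
  go n       .[]           _     | empty = P[]
  go zero    .(l ++ m ∷ r) |q|≤0 | at-max l m r _ _ = ⊥-elim (length-++-∷≰0 l m r |q|≤0)
  go (suc n) .(l ++ m ∷ r) |q|≤n | at-max l m r l<m r≤m =
    P-max l m r l<m r≤m (go n l (proj₁ parts)) (go n r (proj₂ parts))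
    where parts = length-parts l m r |q|≤n

build-[] : ∀ f → build f [] ≡ nil
build-[] zero    = refl
build-[] (suc f) = refl

build-fuel : ∀ q f g → length q ≤ f → length q ≤ g → build f q ≡ build g q
build-fuel = max-induction _ P[] P-max
  where
  P[] : ∀ f g → 0 ≤ f → 0 ≤ g → build f [] ≡ build g []
  P[] f g _ _ = trans (build-[] f) (sym (build-[] g))
  P-max : ∀ l m r → All (_< m) l → All (_≤ m) r
        → (∀ f g → length l ≤ f → length l ≤ g → build f l ≡ build g l)
        → (∀ f g → length r ≤ f → length r ≤ g → build f r ≡ build g r)
        → ∀ f g → length (l ++ m ∷ r) ≤ f → length (l ++ m ∷ r) ≤ g
        → build f (l ++ m ∷ r) ≡ build g (l ++ m ∷ r)
  P-max l m r _ _ _ _ zero _ hf _ = ⊥-elim (length-++-∷≰0 l m r hf)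
  P-max l m r _ _ _ _ (suc f) zero _ hg = ⊥-elim (length-++-∷≰0 l m r hg)
  P-max l m r l<m r≤m IHl IHr (suc f) (suc g) hf hg = begin
    build (suc f) (l ++ m ∷ r)
      ≡⟨ build-++-max f l m r l<m r≤m ⟩
    node (build f l) (build f r)
      ≡⟨ cong₂ node (IHl f g (proj₁ pf) (proj₁ pg)) (IHr f g (proj₂ pf) (proj₂ pg)) ⟩
    node (build g l) (build g r)
      ≡⟨ build-++-max g l m r l<m r≤m ⟨
    build (suc g) (l ++ m ∷ r) ∎
    where
    open ≡-Reasoning
    pf = length-parts l m r hf
    pg = length-parts l m r hg

T-++-max : ∀ l m r → All (_< m) l → All (_≤ m) r → T (l ++ m ∷ r) ≡ node (T l) (T r)
T-++-max l m r l<m r≤m = begin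
  build (length (l ++ m ∷ r)) (l ++ m ∷ r)            ≡⟨ cong (λ f → build f (l ++ m ∷ r)) (length-++-∷ l m r) ⟩
  build (suc (length l +ℕ length r)) (l ++ m ∷ r)      ≡⟨ build-++-max _ l m r l<m r≤m ⟩
  node (build (length l +ℕ length r) l) (build (length l +ℕ length r) r)
    ≡⟨ cong₂ node (build-fuel l _ _ (ℕP.m≤m+n _ _) ℕP.≤-refl) (build-fuel r _ _ (ℕP.m≤n+m _ _) ℕP.≤-refl) ⟩
  node (T l) (T r)                                     ∎
  where open ≡-Reasoning

size : Tree → ℕ
size nil        = 0
size (node l r) = suc (size l +ℕ size r)

size-T : ∀ q → size (T q) ≡ length q
size-T = max-induction _ refl λ l m r l<m r≤m |Tl| |Tr| →
  trans (cong size (T-++-max l m r l<m r≤m))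
        (trans (cong suc (cong₂ _+ℕ_ |Tl| |Tr|)) (sym (length-++-∷ l m r)))

-- cut i t splits t, read in in-order, into the trees of its first i vertices and of the rest.
cut : ℕ → Tree → Tree × Tree
cut i nil        = nil , nil
cut i (node l r) = if i ≤ᵇ size l
  then map₂ (λ b → node b r) (cut i l)
  else map₁ (node l) (cut (i ∸ suc (size l)) r)

cut-left : ∀ {i} l r → i ≤ size l → cut i (node l r) ≡ map₂ (λ b → node b r) (cut i l)
cut-left l r i≤ rewrite Equivalence.to T-≡ (ℕP.≤⇒≤ᵇ i≤) = refl

cut-right : ∀ j l r → cut (suc (size l +ℕ j)) (node l r) ≡ map₁ (node l) (cut j r)
cut-right j l r with suc (size l +ℕ j) ≤ᵇ size l in eq
... | true  = contradiction (ℕP.≤ᵇ⇒≤ _ _ (Equivalence.from T-≡ eq)) (ℕP.≤⇒≯ (ℕP.m≤m+n (size l) j))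
... | false = cong (λ i → map₁ (node l) (cut i r)) (ℕP.m+n∸m≡n (size l) j)

cut-right-size : ∀ j l r {a} → size l ≡ a → cut (suc (a +ℕ j)) (node l r) ≡ map₁ (node l) (cut j r)
cut-right-size j l r refl = cut-right j l r

take-++-≤ : ∀ i (l s : List ℕ) → i ≤ length l → take i (l ++ s) ≡ take i l
take-++-≤ zero    l       s _         = refl
take-++-≤ (suc i) (y ∷ l) s (s≤s i≤l) = cong (y ∷_) (take-++-≤ i l s i≤l)

drop-++-≤ : ∀ i (l s : List ℕ) → i ≤ length l → drop i (l ++ s) ≡ drop i l ++ s
drop-++-≤ zero    l       s _         = refl
drop-++-≤ (suc i) (y ∷ l) s (s≤s i≤l) = drop-++-≤ i l s i≤l

take-++-∷ : ∀ j (l : List ℕ) m r → take (suc (length l +ℕ j)) (l ++ m ∷ r) ≡ l ++ m ∷ take j r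
take-++-∷ j []      m r = refl
take-++-∷ j (y ∷ l) m r = cong (y ∷_) (take-++-∷ j l m r)

drop-++-∷ : ∀ j (l : List ℕ) m r → drop (suc (length l +ℕ j)) (l ++ m ∷ r) ≡ drop j r
drop-++-∷ j []      m r = refl
drop-++-∷ j (y ∷ l) m r = drop-++-∷ j l m r

≤⇒∃+ : ∀ {a b} → a ≤ b → ∃[ d ] b ≡ a +ℕ d
≤⇒∃+ a≤b = _ , sym (ℕP.m+[n∸m]≡n a≤b)

cut-T : ∀ q i → i ≤ length q → cut i (T q) ≡ (T (take i q) , T (drop i q))
cut-T = max-induction _ (λ { .0 z≤n → refl }) P-max
  where
  P-max : ∀ l m r → All (_< m) l → All (_≤ m) r
        → (∀ i → i ≤ length l → cut i (T l) ≡ (T (take i l) , T (drop i l)))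
        → (∀ i → i ≤ length r → cut i (T r) ≡ (T (take i r) , T (drop i r)))
        → ∀ i → i ≤ length (l ++ m ∷ r)
        → cut i (T (l ++ m ∷ r)) ≡ (T (take i (l ++ m ∷ r)) , T (drop i (l ++ m ∷ r)))
  P-max l m r l<m r≤m IHl IHr i i≤ with i ℕ.≤? length l
  ... | yes i≤l = begin
    cut i (T (l ++ m ∷ r))
      ≡⟨ cong (cut i) (T-++-max l m r l<m r≤m) ⟩
    cut i (node (T l) (T r))
      ≡⟨ cut-left (T l) (T r) (subst (i ≤_) (sym (size-T l)) i≤l) ⟩
    map₂ (λ b → node b (T r)) (cut i (T l))
      ≡⟨ cong (map₂ (λ b → node b (T r))) (IHl i i≤l) ⟩
    (T (take i l) , node (T (drop i l)) (T r))
      ≡⟨ cong (T (take i l) ,_) (T-++-max (drop i l) m r (Allₚ.drop⁺ i l<m) r≤m) ⟨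
    (T (take i l) , T (drop i l ++ m ∷ r))
      ≡⟨ cong₂ (λ a b → T a , T b) (take-++-≤ i l (m ∷ r) i≤l) (drop-++-≤ i l (m ∷ r) i≤l) ⟨
    (T (take i (l ++ m ∷ r)) , T (drop i (l ++ m ∷ r))) ∎
    where open ≡-Reasoning
  ... | no i≰l with j , refl ← ≤⇒∃+ (ℕP.≰⇒> i≰l) = begin
    cut i (T (l ++ m ∷ r))
      ≡⟨ cong (cut i) (T-++-max l m r l<m r≤m) ⟩
    cut i (node (T l) (T r))
      ≡⟨ cut-right-size j (T l) (T r) (size-T l) ⟩
    map₁ (node (T l)) (cut j (T r))
      ≡⟨ cong (map₁ (node (T l))) (IHr j j≤r) ⟩
    (node (T l) (T (take j r)) , T (drop j r))
      ≡⟨ cong (_, T (drop j r)) (T-++-max l m (take j r) l<m (Allₚ.take⁺ j r≤m)) ⟨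
    (T (l ++ m ∷ take j r) , T (drop j r))
      ≡⟨ cong₂ (λ a b → T a , T b) (take-++-∷ j l m r) (drop-++-∷ j l m r) ⟨
    (T (take i (l ++ m ∷ r)) , T (drop i (l ++ m ∷ r))) ∎
    where
    open ≡-Reasoning
    j≤r : j ≤ length r
    j≤r = ℕP.+-cancelˡ-≤ (length l) j (length r) (ℕ.s≤s⁻¹ (subst (_ ≤_) (length-++-∷ l m r) i≤))

-- Rational arithmetic and finite sums

fromℚᵘ-* : ∀ p q → fromℚᵘ (p ℚᵘ.* q) ≡ fromℚᵘ p * fromℚᵘ q
fromℚᵘ-* p q = ℚP.toℚᵘ-injective (ℚᵘP.≃-trans (ℚP.toℚᵘ-fromℚᵘ (p ℚᵘ.* q)) (ℚᵘP.≃-sym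
  (ℚᵘP.≃-trans (ℚP.toℚᵘ-homo-* (fromℚᵘ p) (fromℚᵘ q))
               (ℚᵘP.*-cong (ℚP.toℚᵘ-fromℚᵘ p) (ℚP.toℚᵘ-fromℚᵘ q)))))

fromℚᵘ-+ : ∀ p q → fromℚᵘ (p ℚᵘ.+ q) ≡ fromℚᵘ p + fromℚᵘ q
fromℚᵘ-+ p q = ℚP.toℚᵘ-injective (ℚᵘP.≃-trans (ℚP.toℚᵘ-fromℚᵘ (p ℚᵘ.+ q)) (ℚᵘP.≃-sym
  (ℚᵘP.≃-trans (ℚP.toℚᵘ-homo-+ (fromℚᵘ p) (fromℚᵘ q))
               (ℚᵘP.+-cong (ℚP.toℚᵘ-fromℚᵘ p) (ℚP.toℚᵘ-fromℚᵘ q)))))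

/-* : ∀ a b d e → (+ a / suc d) * (+ b / suc e) ≡ + (a *ℕ b) / (suc d *ℕ suc e)
/-* a b d e = trans (sym (fromℚᵘ-* (mkℚᵘ (+ a) d) (mkℚᵘ (+ b) e)))
  (ℚP.fromℚᵘ-cong {mkℚᵘ (+ a) d ℚᵘ.* mkℚᵘ (+ b) e} {mkℚᵘ (+ (a *ℕ b)) (e +ℕ d *ℕ suc e)}
    (*≡* (cong (ℤ._* (+ suc (e +ℕ d *ℕ suc e))) (sym (ℤP.pos-* a b)))))

/-+ : ∀ a b d e → (+ a / suc d) + (+ b / suc e) ≡ + (a *ℕ suc e +ℕ b *ℕ suc d) / (suc d *ℕ suc e)
/-+ a b d e = trans (sym (fromℚᵘ-+ (mkℚᵘ (+ a) d) (mkℚᵘ (+ b) e)))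
  (ℚP.fromℚᵘ-cong {mkℚᵘ (+ a) d ℚᵘ.+ mkℚᵘ (+ b) e}
                   {mkℚᵘ (+ (a *ℕ suc e +ℕ b *ℕ suc d)) (e +ℕ d *ℕ suc e)}
    (*≡* (cong (ℤ._* (+ suc (e +ℕ d *ℕ suc e)))
    (trans (cong₂ ℤ._+_ (sym (ℤP.pos-* a (suc e))) (sym (ℤP.pos-* b (suc d)))) (sym (ℤP.pos-+ (a *ℕ suc e) _))))))

ℕ→ℚ-+ : ∀ a b → ℕ→ℚ (a +ℕ b) ≡ ℕ→ℚ a + ℕ→ℚ b
ℕ→ℚ-+ a b = sym (trans (/-+ a b 0 0) (cong (λ c → + c / 1) (cong₂ _+ℕ_ (ℕP.*-identityʳ a) (ℕP.*-identityʳ b))))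

ℕ→ℚ-* : ∀ a b → ℕ→ℚ (a *ℕ b) ≡ ℕ→ℚ a * ℕ→ℚ b
ℕ→ℚ-* a b = sym (/-* a b 0 0)

ℕ→ℚ-suc : ∀ x → ℕ→ℚ (suc x) ≡ ℕ→ℚ x + 1ℚ
ℕ→ℚ-suc x = trans (cong ℕ→ℚ (ℕP.+-comm 1 x)) (ℕ→ℚ-+ x 1)

ℕ→ℚ-2*suc : ∀ m → ℕ→ℚ (2 *ℕ suc m) ≡ ℕ→ℚ (suc (2 *ℕ m)) + 1ℚ
ℕ→ℚ-2*suc m = trans (cong ℕ→ℚ (ℕP.*-suc 2 m)) (ℕ→ℚ-suc (suc (2 *ℕ m)))

ℕ→ℚ-nonneg : ∀ a → 0ℚ ≤ℚ ℕ→ℚ a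
ℕ→ℚ-nonneg a = ℚP.nonNegative⁻¹ (ℕ→ℚ a) {{ℚP.normalize-nonNeg a 1}}

ℕ→ℚ-pos : ∀ x → ℚ.Positive (ℕ→ℚ (suc x))
ℕ→ℚ-pos x = ℚP.normalize-pos (suc x) 1

ℕ→ℚ-mono : ∀ {a b} → a ≤ b → ℕ→ℚ a ≤ℚ ℕ→ℚ b
ℕ→ℚ-mono {a} {b} a≤b = subst₂ _≤ℚ_ (ℚP.+-identityʳ (ℕ→ℚ a))
  (trans (sym (ℕ→ℚ-+ a (b ∸ a))) (cong ℕ→ℚ (ℕP.m+[n∸m]≡n a≤b)))
  (ℚP.+-monoʳ-≤ (ℕ→ℚ a) (ℕ→ℚ-nonneg (b ∸ a)))

/≡*1/ : ∀ a D .{{_ : NonZero D}} → + a / D ≡ ℕ→ℚ a * (+ 1 / D)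
/≡*1/ a (suc d) = sym (trans (/-* a 1 0 d) (ℚP./-cong (cong +_ (ℕP.*-identityʳ a)) (ℕP.+-identityʳ (suc d))))

1/-* : ∀ D E .{{_ : NonZero D}} .{{_ : NonZero E}} →
       (+ 1 / (D *ℕ E)) {{ℕP.m*n≢0 D E}} ≡ (+ 1 / D) * (+ 1 / E)
1/-* (suc d) (suc e) = sym (/-* 1 1 d e)

*-1/ : ∀ D .{{_ : NonZero D}} → ℕ→ℚ D * (+ 1 / D) ≡ 1ℚ
*-1/ (suc d) = trans (sym (/≡*1/ (suc d) (suc d)))
  (ℚP.fromℚᵘ-cong {mkℚᵘ (+ suc d) d} {mkℚᵘ (+ 1) 0} (*≡* (ℤP.*-comm (+ suc d) (+ 1))))

*-cancel-1/ : ∀ D .{{_ : NonZero D}} x → ℕ→ℚ D * (x * (+ 1 / D)) ≡ x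
*-cancel-1/ D x = begin
  ℕ→ℚ D * (x * (+ 1 / D))   ≡⟨ cong (ℕ→ℚ D *_) (ℚP.*-comm x (+ 1 / D)) ⟩
  ℕ→ℚ D * ((+ 1 / D) * x)   ≡⟨ ℚP.*-assoc (ℕ→ℚ D) (+ 1 / D) x ⟨
  ℕ→ℚ D * (+ 1 / D) * x     ≡⟨ cong (_* x) (*-1/ D) ⟩
  1ℚ * x                    ≡⟨ ℚP.*-identityˡ x ⟩
  x                         ∎
  where open ≡-Reasoning

/-nonneg : ∀ a D .{{_ : NonZero D}} → 0ℚ ≤ℚ + a / D
/-nonneg a D = ℚP.nonNegative⁻¹ _ {{ℚP.normalize-nonNeg a D}}

*-cancelˡ-suc : ∀ n {x y} → ℕ→ℚ (suc n) * x ≡ ℕ→ℚ (suc n) * y → x ≡ y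
*-cancelˡ-suc n {x} {y} eq = trans (sym (unscale x)) (trans (cong (_* (+ 1 / suc n)) eq) (unscale y))
  where
  unscale : ∀ z → ℕ→ℚ (suc n) * z * (+ 1 / suc n) ≡ z
  unscale z = begin
    ℕ→ℚ (suc n) * z * (+ 1 / suc n)   ≡⟨ cong (_* (+ 1 / suc n)) (ℚP.*-comm (ℕ→ℚ (suc n)) z) ⟩
    z * ℕ→ℚ (suc n) * (+ 1 / suc n)   ≡⟨ ℚP.*-assoc z _ _ ⟩
    z * (ℕ→ℚ (suc n) * (+ 1 / suc n)) ≡⟨ cong (z *_) (*-1/ (suc n)) ⟩
    z * 1ℚ                             ≡⟨ ℚP.*-identityʳ z ⟩
    z                                  ∎
    where open ≡-Reasoning

*-nonneg : ∀ {p q} → 0ℚ ≤ℚ p → 0ℚ ≤ℚ q → 0ℚ ≤ℚ p * q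
*-nonneg {p} {q} 0≤p 0≤q =
  ℚP.nonNegative⁻¹ _ {{ℚP.nonNeg*nonNeg⇒nonNeg p {{ℚ.nonNegative 0≤p}} q {{ℚ.nonNegative 0≤q}}}}

+-nonneg : ∀ {p q} → 0ℚ ≤ℚ p → 0ℚ ≤ℚ q → 0ℚ ≤ℚ p + q
+-nonneg {p} {q} 0≤p 0≤q = subst (_≤ℚ p + q) (ℚP.+-identityˡ 0ℚ) (ℚP.+-mono-≤ 0≤p 0≤q)

*-monoˡ-≤ : ∀ {p q} r → 0ℚ ≤ℚ r → p ≤ℚ q → r * p ≤ℚ r * q
*-monoˡ-≤ r 0≤r = ℚP.*-monoˡ-≤-nonNeg r {{ℚ.nonNegative 0≤r}}

*-monoʳ-≤ : ∀ {p q} r → 0ℚ ≤ℚ r → p ≤ℚ q → p * r ≤ℚ q * r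
*-monoʳ-≤ r 0≤r = ℚP.*-monoʳ-≤-nonNeg r {{ℚ.nonNegative 0≤r}}

p≤q+p : ∀ {p q} → 0ℚ ≤ℚ q → p ≤ℚ q + p
p≤q+p {p} {q} 0≤q = ℚP.≤-trans (ℚP.≤-reflexive (sym (ℚP.+-identityˡ p))) (ℚP.+-monoˡ-≤ p 0≤q)

p≤p+q : ∀ {p q} → 0ℚ ≤ℚ q → p ≤ℚ p + q
p≤p+q {p} {q} 0≤q = ℚP.≤-trans (ℚP.≤-reflexive (sym (ℚP.+-identityʳ p))) (ℚP.+-monoʳ-≤ p 0≤q)

p-q≤p : ∀ {p q} → 0ℚ ≤ℚ q → p - q ≤ℚ p
p-q≤p {p} {q} 0≤q = ℚP.≤-trans (ℚP.+-monoʳ-≤ p (ℚP.neg-antimono-≤ 0≤q)) (ℚP.≤-reflexive (ℚP.+-identityʳ p))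

p+p≡2*p : ∀ p → p + p ≡ ℕ→ℚ 2 * p
p+p≡2*p = solve 1 (λ p → p :+ p := con (ℕ→ℚ 2) :* p) refl

-q≤p≤q⇒∣p∣≤q : ∀ {p q} → - q ≤ℚ p → p ≤ℚ q → ∣ p ∣ ≤ℚ q
-q≤p≤q⇒∣p∣≤q {p} {q} -q≤p p≤q with ℚP.∣p∣≡p∨∣p∣≡-p p
... | inj₁ ∣p∣≡p  = subst (_≤ℚ q) (sym ∣p∣≡p) p≤q
... | inj₂ ∣p∣≡-p = subst (_≤ℚ q) (sym ∣p∣≡-p) (subst (- p ≤ℚ_) (neg-neg q) (ℚP.neg-antimono-≤ -q≤p))
  where
  neg-neg : ∀ p → - (- p) ≡ p
  neg-neg = solve 1 (λ p → :- (:- p) := p) refl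

p*p≤1⇒p≤1 : ∀ {p} → p * p ≤ℚ 1ℚ → p ≤ℚ 1ℚ
p*p≤1⇒p≤1 {p} p²≤1 with p ℚP.≤? 1ℚ
... | yes p≤1 = p≤1
... | no  p≰1 = contradiction (ℚP.<-≤-trans (ℚP.<-trans 1<p p<p²) p²≤1) (ℚP.<-irrefl refl)
  where
  1<p = ℚP.≰⇒> p≰1
  p<p² : p <ℚ p * p
  p<p² = subst (_<ℚ p * p) (ℚP.*-identityˡ p)
           (ℚP.*-monoˡ-<-pos p {{ℚ.positive (ℚP.<-trans (ℚP.positive⁻¹ 1ℚ) 1<p)}} 1<p)

archimedean : ∀ ε → 0ℚ <ℚ ε → ∃[ q ] 1ℚ ≤ℚ ε * ℕ→ℚ (suc q)
archimedean (ℚ.mkℚ (+ 0)        _ _) (ℚ.*<* (ℤ.+<+ ()))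
archimedean (ℚ.mkℚ ℤ.-[1+ _ ]  _ _) (ℚ.*<* ())
archimedean ε@(ℚ.mkℚ (+ suc p) q _) _ = q , (begin
  1ℚ                                           ≤⟨ ℕ→ℚ-mono (s≤s (z≤n {p})) ⟩
  ℕ→ℚ (suc p)                                  ≡⟨ *-cancel-1/ (suc q) (ℕ→ℚ (suc p)) ⟨
  ℕ→ℚ (suc q) * (ℕ→ℚ (suc p) * (+ 1 / suc q))  ≡⟨ cong (ℕ→ℚ (suc q) *_) (/≡*1/ (suc p) (suc q)) ⟨
  ℕ→ℚ (suc q) * (+ suc p / suc q)              ≡⟨ cong (ℕ→ℚ (suc q) *_) (ℚP.↥p/↧p≡p ε) ⟩
  ℕ→ℚ (suc q) * ε                              ≡⟨ ℚP.*-comm (ℕ→ℚ (suc q)) ε ⟩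
  ε * ℕ→ℚ (suc q)                              ∎)
  where open ℚP.≤-Reasoning

∑ : {A : Set} → List A → (A → ℚ) → ℚ
∑ L h = sumℚ (map h L)

Additive : {A : Set} → ((A → ℚ) → ℚ) → Set
Additive Φ = ∀ g h → Φ (λ x → g x + h x) ≡ Φ g + Φ h

∑-++ : ∀ {A : Set} (L L′ : List A) h → ∑ (L ++ L′) h ≡ ∑ L h + ∑ L′ h
∑-++ []      L′ h = sym (ℚP.+-identityˡ _)
∑-++ (x ∷ L) L′ h = trans (cong (_+_ (h x)) (∑-++ L L′ h)) (sym (ℚP.+-assoc (h x) _ _))

∑-concatMap : ∀ {A B : Set} (f : A → List B) L h → ∑ (concatMap f L) h ≡ ∑ L (λ x → ∑ (f x) h)
∑-concatMap f []      h = refl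
∑-concatMap f (x ∷ L) h = trans (∑-++ (f x) (concatMap f L) h) (cong (_+_ (∑ (f x) h)) (∑-concatMap f L h))

∑-map : ∀ {A B : Set} (g : A → B) L h → ∑ (map g L) h ≡ ∑ L (λ x → h (g x))
∑-map g []      h = refl
∑-map g (x ∷ L) h = cong (_+_ (h (g x))) (∑-map g L h)

∑-cong : ∀ {A : Set} {P : A → Set} {L h h′} → All P L → (∀ x → P x → h x ≡ h′ x) → ∑ L h ≡ ∑ L h′
∑-cong []       e = refl
∑-cong (p ∷ ps) e = cong₂ _+_ (e _ p) (∑-cong ps e)

∑-mono : ∀ {A : Set} {P : A → Set} {L h h′} → All P L → (∀ x → P x → h x ≤ℚ h′ x) → ∑ L h ≤ℚ ∑ L h′
∑-mono []       e = ℚP.≤-refl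
∑-mono (p ∷ ps) e = ℚP.+-mono-≤ (e _ p) (∑-mono ps e)

∑-+ : ∀ {A : Set} (L : List A) → Additive (∑ L)
∑-+ []      g h = sym (ℚP.+-identityˡ 0ℚ)
∑-+ (x ∷ L) g h = trans (cong (_+_ (g x + h x)) (∑-+ L g h)) (interchange (g x) (h x) (∑ L g) (∑ L h))

∑-*ˡ : ∀ {A : Set} (L : List A) c h → ∑ L (λ x → c * h x) ≡ c * ∑ L h
∑-*ˡ []      c h = sym (ℚP.*-zeroʳ c)
∑-*ˡ (x ∷ L) c h = trans (cong (_+_ (c * h x)) (∑-*ˡ L c h)) (sym (ℚP.*-distribˡ-+ c (h x) (∑ L h)))

∑-commute : ∀ {A B : Set} (L : List A) (Φ : (B → ℚ) → ℚ) → Additive Φ → Φ (λ _ → 0ℚ) ≡ 0ℚ →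
            ∀ (h : A → B → ℚ) → Φ (λ y → ∑ L (λ x → h x y)) ≡ ∑ L (λ x → Φ (h x))
∑-commute []      Φ Φ-+ Φ-0 h = Φ-0
∑-commute (x ∷ L) Φ Φ-+ Φ-0 h = trans (Φ-+ (h x) _) (cong (_+_ (Φ (h x))) (∑-commute L Φ Φ-+ Φ-0 h))

∑-0 : ∀ {A : Set} (L : List A) → ∑ L (λ _ → 0ℚ) ≡ 0ℚ
∑-0 []      = refl
∑-0 (x ∷ L) = trans (ℚP.+-identityˡ _) (∑-0 L)

ℕ→ℚ-sum : ∀ {A : Set} (L : List A) h → ℕ→ℚ (sumℕ (map h L)) ≡ ∑ L (λ x → ℕ→ℚ (h x))
ℕ→ℚ-sum []      h = refl
ℕ→ℚ-sum (x ∷ L) h = trans (ℕ→ℚ-+ (h x) _) (cong (_+_ (ℕ→ℚ (h x))) (ℕ→ℚ-sum L h))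

∑< : ℕ → (ℕ → ℚ) → ℚ
∑< zero    g = 0ℚ
∑< (suc n) g = g 0 + ∑< n (λ i → g (suc i))

Σ1-∑< : ∀ n g → Σ1 n g ≡ ∑< n (λ i → g (suc i))
Σ1-∑< n g = go (λ i → i) n
  where
  go : ∀ f n → sumℚ (map (λ i → g (suc i)) (applyUpTo f n)) ≡ ∑< n (λ i → g (suc (f i)))
  go f zero    = refl
  go f (suc n) = cong (_+_ (g (suc (f 0)))) (go (λ i → f (suc i)) n)

∑<-cong : ∀ n {g g′} → (∀ i → i < n → g i ≡ g′ i) → ∑< n g ≡ ∑< n g′
∑<-cong zero    e = refl
∑<-cong (suc n) e = cong₂ _+_ (e 0 (s≤s z≤n)) (∑<-cong n (λ i i<n → e (suc i) (s≤s i<n)))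

∑<-mono : ∀ n {g g′} → (∀ i → i < n → g i ≤ℚ g′ i) → ∑< n g ≤ℚ ∑< n g′
∑<-mono zero    e = ℚP.≤-refl
∑<-mono (suc n) e = ℚP.+-mono-≤ (e 0 (s≤s z≤n)) (∑<-mono n (λ i i<n → e (suc i) (s≤s i<n)))

∑<-*ˡ : ∀ n c g → ∑< n (λ i → c * g i) ≡ c * ∑< n g
∑<-*ˡ zero    c g = sym (ℚP.*-zeroʳ c)
∑<-*ˡ (suc n) c g = trans (cong (_+_ (c * g 0)) (∑<-*ˡ n c _)) (sym (ℚP.*-distribˡ-+ c (g 0) _))

∑<-split : ∀ a b g → ∑< (a +ℕ b) g ≡ ∑< a g + ∑< b (λ i → g (a +ℕ i))
∑<-split zero    b g = sym (ℚP.+-identityˡ _)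
∑<-split (suc a) b g = trans (cong (_+_ (g 0)) (∑<-split a b _)) (sym (ℚP.+-assoc (g 0) _ _))

∑<-snoc : ∀ n g → ∑< (suc n) g ≡ ∑< n g + g n
∑<-snoc zero    g = trans (ℚP.+-identityʳ (g 0)) (sym (ℚP.+-identityˡ (g 0)))
∑<-snoc (suc n) g = trans (cong (_+_ (g 0)) (∑<-snoc n _)) (sym (ℚP.+-assoc (g 0) _ _))

Σ1-snoc : ∀ n g → Σ1 (suc n) g ≡ Σ1 n g + g (suc n)
Σ1-snoc n g = trans (Σ1-∑< (suc n) g) (trans (∑<-snoc n (λ i → g (suc i))) (cong (_+ g (suc n)) (sym (Σ1-∑< n g))))

∑<-const : ∀ n c → ∑< n (λ _ → c) ≡ ℕ→ℚ n * c
∑<-const zero    c = sym (ℚP.*-zeroˡ c)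
∑<-const (suc n) c = begin
  c + ∑< n (λ _ → c)       ≡⟨ cong (_+_ c) (∑<-const n c) ⟩
  c + ℕ→ℚ n * c            ≡⟨ cong (_+ ℕ→ℚ n * c) (ℚP.*-identityˡ c) ⟨
  1ℚ * c + ℕ→ℚ n * c       ≡⟨ ℚP.*-distribʳ-+ c 1ℚ (ℕ→ℚ n) ⟨
  (1ℚ + ℕ→ℚ n) * c         ≡⟨ cong (_* c) (ℕ→ℚ-+ 1 n) ⟨
  ℕ→ℚ (suc n) * c          ∎
  where open ≡-Reasoning

∑<-nonneg : ∀ n b → (∀ m → 0ℚ ≤ℚ b m) → 0ℚ ≤ℚ ∑< n b
∑<-nonneg n b 0≤b =
  subst (_≤ℚ ∑< n b) (trans (∑<-const n 0ℚ) (ℚP.*-zeroʳ (ℕ→ℚ n))) (∑<-mono n (λ i _ → 0≤b i))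

∑<-telescope : ∀ (b u : ℕ → ℚ) K → (∀ m → b m ≤ℚ K * (u m - u (suc m))) →
               ∀ d → ∑< d b ≤ℚ K * (u 0 - u d)
∑<-telescope b u K b≤ zero    = ℚP.≤-reflexive (sym (trans (cong (K *_) (ℚP.+-inverseʳ (u 0))) (ℚP.*-zeroʳ K)))
∑<-telescope b u K b≤ (suc d) = begin
  ∑< (suc d) b                                  ≡⟨ ∑<-snoc d b ⟩
  ∑< d b + b d                                  ≤⟨ ℚP.+-mono-≤ (∑<-telescope b u K b≤ d) (b≤ d) ⟩
  K * (u 0 - u d) + K * (u d - u (suc d))       ≡⟨ collapse K (u 0) (u d) (u (suc d)) ⟩
  K * (u 0 - u (suc d))                         ∎
  where
  open ℚP.≤-Reasoning
  collapse : ∀ K x y z → K * (x - y) + K * (y - z) ≡ K * (x - z)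
  collapse = solve 4 (λ K x y z → K :* (x :- y) :+ K :* (y :- z) := K :* (x :- z)) refl

-- ∑ₐ n g is the sum of g j w over the antidiagonal j + w = n.
∑ₐ : ℕ → (ℕ → ℕ → ℚ) → ℚ
∑ₐ zero    g = g 0 0
∑ₐ (suc n) g = g 0 (suc n) + ∑ₐ n (λ j w → g (suc j) w)

∑ₐ-cong : ∀ n {g g′} → (∀ j w → j +ℕ w ≡ n → g j w ≡ g′ j w) → ∑ₐ n g ≡ ∑ₐ n g′
∑ₐ-cong zero    e = e 0 0 refl
∑ₐ-cong (suc n) e = cong₂ _+_ (e 0 (suc n) refl) (∑ₐ-cong n (λ j w eq → e (suc j) w (cong suc eq)))

∑ₐ-mono : ∀ n {g g′} → (∀ j w → j +ℕ w ≡ n → g j w ≤ℚ g′ j w) → ∑ₐ n g ≤ℚ ∑ₐ n g′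
∑ₐ-mono zero    e = e 0 0 refl
∑ₐ-mono (suc n) e = ℚP.+-mono-≤ (e 0 (suc n) refl) (∑ₐ-mono n (λ j w eq → e (suc j) w (cong suc eq)))

∑ₐ-commute : ∀ {A : Set} n (Φ : (A → ℚ) → ℚ) → Additive Φ →
             ∀ (h : ℕ → ℕ → A → ℚ) → Φ (λ x → ∑ₐ n (λ j w → h j w x)) ≡ ∑ₐ n (λ j w → Φ (h j w))
∑ₐ-commute zero    Φ Φ-+ h = refl
∑ₐ-commute (suc n) Φ Φ-+ h =
  trans (Φ-+ (h 0 (suc n)) _) (cong (_+_ (Φ (h 0 (suc n)))) (∑ₐ-commute n Φ Φ-+ (λ j → h (suc j))))

∑ₐ-+ : ∀ n g h → ∑ₐ n (λ j w → g j w + h j w) ≡ ∑ₐ n g + ∑ₐ n h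
∑ₐ-+ zero    g h = refl
∑ₐ-+ (suc n) g h = trans (cong (_+_ (g 0 (suc n) + h 0 (suc n))) (∑ₐ-+ n _ _))
                         (interchange (g 0 (suc n)) (h 0 (suc n)) _ _)

∑ₐ-assoc : ∀ n (g : ℕ → ℕ → ℕ → ℚ) →
           ∑ₐ n (λ j w → ∑ₐ j (λ x z → g x z w)) ≡ ∑ₐ n (λ x m → ∑ₐ m (λ z w → g x z w))
∑ₐ-assoc zero    g = refl
∑ₐ-assoc (suc n) g = begin
  g 0 0 (suc n) + ∑ₐ n (λ j w → g 0 (suc j) w + ∑ₐ j (λ x z → g (suc x) z w))
    ≡⟨ cong (_+_ (g 0 0 (suc n))) (∑ₐ-+ n _ _) ⟩
  g 0 0 (suc n) + (∑ₐ n (λ j w → g 0 (suc j) w) + ∑ₐ n (λ j w → ∑ₐ j (λ x z → g (suc x) z w)))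
    ≡⟨ ℚP.+-assoc (g 0 0 (suc n)) _ _ ⟨
  ∑ₐ (suc n) (g 0) + ∑ₐ n (λ j w → ∑ₐ j (λ x z → g (suc x) z w))
    ≡⟨ cong (_+_ (∑ₐ (suc n) (g 0))) (∑ₐ-assoc n (λ x → g (suc x))) ⟩
  ∑ₐ (suc n) (g 0) + ∑ₐ n (λ x m → ∑ₐ m (λ z w → g (suc x) z w)) ∎
  where open ≡-Reasoning

∑ₐ-snoc : ∀ n g → ∑ₐ (suc n) g ≡ ∑ₐ n (λ j w → g j (suc w)) + g (suc n) 0
∑ₐ-snoc zero    g = refl
∑ₐ-snoc (suc n) g = trans (cong (_+_ (g 0 (suc (suc n)))) (∑ₐ-snoc n (λ j → g (suc j))))
                           (sym (ℚP.+-assoc (g 0 (suc (suc n))) _ _))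

∑ₐ-swap : ∀ n g → ∑ₐ n g ≡ ∑ₐ n (λ j w → g w j)
∑ₐ-swap zero    g = refl
∑ₐ-swap (suc n) g = begin
  g 0 (suc n) + ∑ₐ n (λ j w → g (suc j) w)   ≡⟨ cong (_+_ (g 0 (suc n))) (∑ₐ-swap n (λ j → g (suc j))) ⟩
  g 0 (suc n) + ∑ₐ n (λ j w → g (suc w) j)   ≡⟨ ℚP.+-comm (g 0 (suc n)) _ ⟩
  ∑ₐ n (λ j w → g (suc w) j) + g 0 (suc n)   ≡⟨ ∑ₐ-snoc n (λ j w → g w j) ⟨
  ∑ₐ (suc n) (λ j w → g w j)                 ∎
  where open ≡-Reasoning

∑ₐ-∑< : ∀ n g → ∑ₐ n g ≡ ∑< (suc n) (λ j → g j (n ∸ j))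
∑ₐ-∑< zero    g = sym (ℚP.+-identityʳ (g 0 0))
∑ₐ-∑< (suc n) g = cong (_+_ (g 0 (suc n))) (∑ₐ-∑< n (λ j → g (suc j)))

∑ₐ-left : ∀ n u → ∑ₐ n (λ j w → u j) ≡ ∑< (suc n) u
∑ₐ-left n u = ∑ₐ-∑< n (λ j w → u j)

∑ₐ-right : ∀ n u → ∑ₐ n (λ j w → u w) ≡ ∑< (suc n) u
∑ₐ-right n u = trans (∑ₐ-swap n (λ j w → u w)) (∑ₐ-left n u)

∑ₐ-*ˡ : ∀ n c g → ∑ₐ n (λ j w → c * g j w) ≡ c * ∑ₐ n g
∑ₐ-*ˡ zero    c g = refl
∑ₐ-*ˡ (suc n) c g = trans (cong (_+_ (c * g 0 (suc n))) (∑ₐ-*ˡ n c _)) (sym (ℚP.*-distribˡ-+ c (g 0 (suc n)) _))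

∑ₐ-weighted : ∀ n g → ℕ→ℚ (suc n) * ∑ₐ (suc n) g
            ≡ ∑ₐ n (λ j w → ℕ→ℚ (suc j) * g (suc j) w) + ∑ₐ n (λ j w → ℕ→ℚ (suc w) * g j (suc w))
∑ₐ-weighted n g = begin
  ℕ→ℚ (suc n) * ∑ₐ (suc n) g
    ≡⟨ ∑ₐ-*ˡ (suc n) (ℕ→ℚ (suc n)) g ⟨
  ∑ₐ (suc n) (λ j w → ℕ→ℚ (suc n) * g j w)
    ≡⟨ ∑ₐ-cong (suc n) (λ j w j+w≡ → trans (cong (λ m → ℕ→ℚ m * g j w) (sym j+w≡))
                                       (trans (cong (_* g j w) (ℕ→ℚ-+ j w))
                                              (ℚP.*-distribʳ-+ (g j w) (ℕ→ℚ j) (ℕ→ℚ w)))) ⟩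
  ∑ₐ (suc n) (λ j w → ℕ→ℚ j * g j w + ℕ→ℚ w * g j w)
    ≡⟨ ∑ₐ-+ (suc n) (λ j w → ℕ→ℚ j * g j w) (λ j w → ℕ→ℚ w * g j w) ⟩
  ∑ₐ (suc n) (λ j w → ℕ→ℚ j * g j w) + ∑ₐ (suc n) (λ j w → ℕ→ℚ w * g j w)
    ≡⟨ cong₂ _+_ (trans (cong (_+ A) (ℚP.*-zeroˡ (g 0 (suc n)))) (ℚP.+-identityˡ A))
                 (trans (∑ₐ-snoc n (λ j w → ℕ→ℚ w * g j w))
                        (trans (cong (_+_ B) (ℚP.*-zeroˡ (g (suc n) 0))) (ℚP.+-identityʳ B))) ⟩
  A + B ∎
  where
  open ≡-Reasoning
  A = ∑ₐ n (λ j w → ℕ→ℚ (suc j) * g (suc j) w)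
  B = ∑ₐ n (λ j w → ℕ→ℚ (suc w) * g j (suc w))

∑ₐ-complement : ∀ n (q r G : ℕ → ℚ) → (∀ j → q j + r j ≡ 1ℚ) →
  ∑ₐ n (λ j w → q j * G w) ≡ ∑ₐ n (λ j w → G w) - ∑ₐ n (λ j w → r j * G w)
∑ₐ-complement n q r G q+r = trans (x≡[x+z]-z (∑ₐ n (λ j w → q j * G w)) (∑ₐ n (λ j w → r j * G w)))
  (cong (_- ∑ₐ n (λ j w → r j * G w)) (trans (sym (∑ₐ-+ n (λ j w → q j * G w) (λ j w → r j * G w)))
    (∑ₐ-cong n (λ j w _ → trans (sym (ℚP.*-distribʳ-+ (G w) (q j) (r j)))
                                 (trans (cong (_* G w) (q+r j)) (ℚP.*-identityˡ (G w)))))))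
  where
  x≡[x+z]-z : ∀ x z → x ≡ (x + z) - z
  x≡[x+z]-z = solve 2 (λ x z → x := (x :+ z) :- z) refl

∑ₐ-inner : ∀ m (r G : ℕ → ℚ) → r 0 ≡ 0ℚ → G 0 ≡ 0ℚ →
  ∑ₐ (suc m) (λ j w → r j * G w) ≡ ∑< m (λ j → r (suc j) * G (m ∸ j))
∑ₐ-inner m r G r0 G0 = begin
  ∑ₐ (suc m) (λ j w → r j * G w)
    ≡⟨ ∑ₐ-∑< (suc m) (λ j w → r j * G w) ⟩
  r 0 * G (suc m) + ∑< (suc m) (λ j → r (suc j) * G (m ∸ j))
    ≡⟨ cong (λ x → x * G (suc m) + I (suc m)) r0 ⟩
  0ℚ * G (suc m) + I (suc m)
    ≡⟨ trans (cong (_+ I (suc m)) (ℚP.*-zeroˡ (G (suc m)))) (ℚP.+-identityˡ _) ⟩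
  I (suc m)
    ≡⟨ ∑<-snoc m (λ j → r (suc j) * G (m ∸ j)) ⟩
  I m + r (suc m) * G (m ∸ m)
    ≡⟨ cong (λ i → I m + r (suc m) * G i) (ℕP.n∸n≡0 m) ⟩
  I m + r (suc m) * G 0
    ≡⟨ cong (λ x → I m + r (suc m) * x) G0 ⟩
  I m + r (suc m) * 0ℚ
    ≡⟨ trans (cong (_+_ (I m)) (ℚP.*-zeroʳ (r (suc m)))) (ℚP.+-identityʳ _) ⟩
  I m ∎
  where
  open ≡-Reasoning
  I : ℕ → ℚ
  I l = ∑< l (λ j → r (suc j) * G (m ∸ j))

-- Averages over permutations

Word : ℕ → List ℕ → Set
Word n p = length p ≡ n × All (_≤ n) p

insertions-words : ∀ x p → All (_≤ x) p →
  All (λ q → length q ≡ suc (length p) × All (_≤ x) q) (insertions x p)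
insertions-words x []      []           = (refl , ℕP.≤-refl ∷ []) ∷ []
insertions-words x (y ∷ p) (y≤x ∷ p≤x) = (refl , ℕP.≤-refl ∷ y≤x ∷ p≤x) ∷
  Allₚ.map⁺ (All.map (λ (|q| , q≤x) → cong suc |q| , y≤x ∷ q≤x) (insertions-words x p p≤x))

perms-words : ∀ n → All (Word n) (perms n)
perms-words zero    = (refl , []) ∷ []
perms-words (suc n) = Allₚ.concat⁺ (Allₚ.map⁺ (All.map extend (perms-words n)))
  where
  extend : ∀ {p} → Word n p → All (Word (suc n)) (insertions (suc n) p)
  extend (refl , p≤n) = insertions-words (suc n) _ (All.map ℕP.m≤n⇒m≤1+n p≤n)

∑-insertions : ∀ x p h → ∑ (insertions x p) h ≡ ∑< (suc (length p)) (λ i → h (take i p ++ x ∷ drop i p))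
∑-insertions x []      h = refl
∑-insertions x (y ∷ p) h =
  cong (_+_ (h (x ∷ y ∷ p))) (trans (∑-map (y ∷_) (insertions x p) h) (∑-insertions x p (λ q → h (y ∷ q))))

graft : ℕ → Tree → Tree
graft i t = node (proj₁ (cut i t)) (proj₂ (cut i t))

T-insert : ∀ {n p} i → Word n p → i ≤ n → T (take i p ++ suc n ∷ drop i p) ≡ graft i (T p)
T-insert {p = p} i (refl , p≤n) i≤n = begin
  T (take i p ++ suc _ ∷ drop i p)
    ≡⟨ T-++-max (take i p) _ (drop i p) (Allₚ.take⁺ i (All.map s≤s p≤n)) (Allₚ.drop⁺ i (All.map ℕP.m≤n⇒m≤1+n p≤n)) ⟩
  node (T (take i p)) (T (drop i p))
    ≡⟨ cong₂ node (cong proj₁ (cut-T p i i≤n)) (cong proj₂ (cut-T p i i≤n)) ⟨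
  graft i (T p) ∎
  where open ≡-Reasoning

1/! : ℕ → ℚ
1/! n = (+ 1 / n !) {{n ℕP.!≢0}}

𝔼 : ℕ → (Tree → ℚ) → ℚ
𝔼 n H = ∑ (perms n) (λ p → H (T p)) * (1/! n)

⟦_⟧ : (Tree → ℕ) → Tree → ℚ
⟦ X ⟧ t = ℕ→ℚ (X t)

E-𝔼 : ∀ n X → E n X ≡ 𝔼 n ⟦ X ⟧
E-𝔼 n X = trans (/≡*1/ (sumℕ (map (λ p → X (T p)) (perms n))) (n !) {{n ℕP.!≢0}})
                (cong (_* (1/! n)) (ℕ→ℚ-sum (perms n) (λ p → X (T p))))

𝔼-zero : ∀ H → 𝔼 0 H ≡ H nil
𝔼-zero H = trans (ℚP.*-identityʳ _) (ℚP.+-identityʳ (H nil))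

𝔼-cong : ∀ n {H H′} → (∀ t → size t ≡ n → H t ≡ H′ t) → 𝔼 n H ≡ 𝔼 n H′
𝔼-cong n e = cong (_* (1/! n)) (∑-cong (perms-words n) (λ p (|p| , _) → e (T p) (trans (size-T p) |p|)))

E-cong : ∀ n {X Y} → (∀ t → X t ≡ Y t) → E n X ≡ E n Y
E-cong n {X} {Y} X≡Y = trans (E-𝔼 n X) (trans (𝔼-cong n (λ t _ → cong ℕ→ℚ (X≡Y t))) (sym (E-𝔼 n Y)))

𝔼-mono : ∀ n {H H′} → (∀ t → size t ≡ n → H t ≤ℚ H′ t) → 𝔼 n H ≤ℚ 𝔼 n H′
𝔼-mono n e = ℚP.*-monoʳ-≤-nonNeg (1/! n) {{ℚ.nonNegative (/-nonneg 1 (n !) {{n ℕP.!≢0}})}}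
  (∑-mono (perms-words n) (λ p (|p| , _) → e (T p) (trans (size-T p) |p|)))

𝔼-+ : ∀ n → Additive (𝔼 n)
𝔼-+ n g h = trans (cong (_* (1/! n)) (∑-+ (perms n) (λ p → g (T p)) (λ p → h (T p))))
  (ℚP.*-distribʳ-+ (1/! n) (∑ (perms n) (λ p → g (T p))) (∑ (perms n) (λ p → h (T p))))

𝔼-*ˡ : ∀ n c H → 𝔼 n (λ t → c * H t) ≡ c * 𝔼 n H
𝔼-*ˡ n c H = trans (cong (_* (1/! n)) (∑-*ˡ (perms n) c _)) (ℚP.*-assoc c _ _)

𝔼-*ʳ : ∀ n c H → 𝔼 n (λ t → H t * c) ≡ 𝔼 n H * c
𝔼-*ʳ n c H = trans (𝔼-cong n (λ t _ → ℚP.*-comm (H t) c)) (trans (𝔼-*ˡ n c H) (ℚP.*-comm c (𝔼 n H)))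

𝔼-0 : ∀ n → 𝔼 n (λ _ → 0ℚ) ≡ 0ℚ
𝔼-0 n = trans (cong (_* (1/! n)) (∑-0 (perms n))) (ℚP.*-zeroˡ (1/! n))

𝔼-nonneg : ∀ n H → (∀ t → 0ℚ ≤ℚ H t) → 0ℚ ≤ℚ 𝔼 n H
𝔼-nonneg n H 0≤H = subst (_≤ℚ 𝔼 n H) (𝔼-0 n) (𝔼-mono n (λ t _ → 0≤H t))

E-nonneg : ∀ n X → 0ℚ ≤ℚ E n X
E-nonneg n X = subst (0ℚ ≤ℚ_) (sym (E-𝔼 n X)) (𝔼-nonneg n ⟦ X ⟧ (λ t → ℕ→ℚ-nonneg (X t)))

𝔼² : ℕ → ℕ → (Tree → Tree → ℚ) → ℚ
𝔼² j w h = 𝔼 j (λ a → 𝔼 w (λ b → h a b))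

𝔼²-+ : ∀ j w g h → 𝔼² j w (λ a b → g a b + h a b) ≡ 𝔼² j w g + 𝔼² j w h
𝔼²-+ j w g h = trans (𝔼-cong j (λ a _ → 𝔼-+ w (g a) (h a))) (𝔼-+ j (λ a → 𝔼 w (g a)) (λ a → 𝔼 w (h a)))

𝔼-swap : ∀ j w (h : Tree → Tree → ℚ) → 𝔼² j w h ≡ 𝔼² w j (λ b a → h a b)
𝔼-swap j w h = sym (trans (𝔼-*ʳ w (1/! j) (λ b → ∑ (perms j) (λ p → h (T p) b)))
  (cong (_* (1/! j)) (∑-commute (perms j) (𝔼 w) (𝔼-+ w) (𝔼-0 w) (λ p b → h (T p) b))))

∑-perms-suc : ∀ n H →
  ∑ (perms (suc n)) (λ p → H (T p)) ≡ ∑ (perms n) (λ p → ∑< (suc n) (λ i → H (graft i (T p))))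
∑-perms-suc n H = trans (∑-concatMap (insertions (suc n)) (perms n) _) (∑-cong (perms-words n) inserted)
  where
  inserted : ∀ p → Word n p → ∑ (insertions (suc n) p) (λ q → H (T q)) ≡ ∑< (suc n) (λ i → H (graft i (T p)))
  inserted p w@(refl , _) = trans (∑-insertions (suc n) p _)
    (∑<-cong (suc n) (λ i i≤n → cong H (T-insert i w (ℕ.s≤s⁻¹ i≤n))))

𝔼-suc : ∀ n H → ℕ→ℚ (suc n) * 𝔼 (suc n) H ≡ 𝔼 n (λ t → ∑< (suc n) (λ i → H (graft i t)))
𝔼-suc n H = begin
  ℕ→ℚ (suc n) * (∑ (perms (suc n)) (λ p → H (T p)) * 1/! (suc n))
    ≡⟨ cong₂ (λ S c → ℕ→ℚ (suc n) * (S * c)) (∑-perms-suc n H) (1/-* (suc n) (n !) {{_}} {{n ℕP.!≢0}}) ⟩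
  ℕ→ℚ (suc n) * (S * ((+ 1 / suc n) * (1/! n)))
    ≡⟨ regroup (ℕ→ℚ (suc n)) S (+ 1 / suc n) (1/! n) ⟩
  ℕ→ℚ (suc n) * (+ 1 / suc n) * (S * (1/! n))
    ≡⟨ cong (_* (S * (1/! n))) (*-1/ (suc n)) ⟩
  1ℚ * (S * (1/! n))
    ≡⟨ ℚP.*-identityˡ _ ⟩
  𝔼 n (λ t → ∑< (suc n) (λ i → H (graft i t))) ∎
  where
  open ≡-Reasoning
  S = ∑ (perms n) (λ p → ∑< (suc n) (λ i → H (graft i (T p))))
  regroup : ∀ m s a b → m * (s * (a * b)) ≡ m * a * (s * b)
  regroup = solve 4 (λ m s a b → m :* (s :* (a :* b)) := m :* a :* (s :* b)) refl

𝔼-const : ∀ n c → 𝔼 n (λ _ → c) ≡ c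
𝔼-const zero    c = 𝔼-zero (λ _ → c)
𝔼-const (suc n) c = *-cancelˡ-suc n (begin
  ℕ→ℚ (suc n) * 𝔼 (suc n) (λ _ → c)   ≡⟨ 𝔼-suc n (λ _ → c) ⟩
  𝔼 n (λ _ → ∑< (suc n) (λ _ → c))    ≡⟨ 𝔼-cong n (λ _ _ → ∑<-const (suc n) c) ⟩
  𝔼 n (λ _ → ℕ→ℚ (suc n) * c)         ≡⟨ 𝔼-const n _ ⟩
  ℕ→ℚ (suc n) * c                      ∎)
  where open ≡-Reasoning

-- Splitting a random tree at its root

CutLaw : ℕ → Set
CutLaw n = ∀ (G : Tree → Tree → ℚ) →
  𝔼 n (λ t → ∑< (suc n) (λ i → G (proj₁ (cut i t)) (proj₂ (cut i t))))
  ≡ ∑ₐ n (λ j w → 𝔼² j w G)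

node-law : ∀ n → CutLaw n → ∀ H →
           ℕ→ℚ (suc n) * 𝔼 (suc n) H ≡ ∑ₐ n (λ j w → 𝔼² j w (λ a b → H (node a b)))
node-law n cut-law H = trans (𝔼-suc n H) (cut-law (λ a b → H (node a b)))

cut-node : ∀ {n j w} (G : Tree → Tree → ℚ) a b → size a ≡ j → size b ≡ w → j +ℕ w ≡ n →
  ∑< (suc (suc n)) (λ i → G (proj₁ (cut i (node a b))) (proj₂ (cut i (node a b))))
  ≡ ∑< (suc j) (λ i → G (proj₁ (cut i a)) (node (proj₂ (cut i a)) b))
  + ∑< (suc w) (λ i → G (node a (proj₁ (cut i b))) (proj₂ (cut i b)))
cut-node {j = j} {w} G a b refl refl refl = begin
  ∑< (suc (suc (j +ℕ w))) (λ i → G′ (cut i (node a b)))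
    ≡⟨ cong (λ m → ∑< (suc m) (λ i → G′ (cut i (node a b)))) (ℕP.+-suc j w) ⟨
  ∑< (suc j +ℕ suc w) (λ i → G′ (cut i (node a b)))
    ≡⟨ ∑<-split (suc j) (suc w) (λ i → G′ (cut i (node a b))) ⟩
  ∑< (suc j) (λ i → G′ (cut i (node a b))) + ∑< (suc w) (λ i → G′ (cut (suc j +ℕ i) (node a b)))
    ≡⟨ cong₂ _+_ (∑<-cong (suc j) (λ i i≤j → cong G′ (cut-left a b (ℕ.s≤s⁻¹ i≤j))))
                 (∑<-cong (suc w) (λ i _ → cong G′ (cut-right i a b))) ⟩
  ∑< (suc j) (λ i → G (proj₁ (cut i a)) (node (proj₂ (cut i a)) b))
  + ∑< (suc w) (λ i → G (node a (proj₁ (cut i b))) (proj₂ (cut i b))) ∎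
  where
  open ≡-Reasoning
  G′ : Tree × Tree → ℚ
  G′ (a , b) = G a b

module CutStep (n : ℕ) (IH : ∀ m → m ≤ n → CutLaw m) (G : Tree → Tree → ℚ) where

  M₁ M₂ : ℕ → ℕ → ℕ → ℚ
  M₁ x z w = 𝔼 x (λ c → 𝔼 z (λ d → 𝔼 w (λ b → G c (node d b))))
  M₂ x z w = 𝔼 x (λ a → 𝔼 z (λ c → 𝔼 w (λ d → G (node a c) d)))

  left-part : ∀ j w → j ≤ n →
    𝔼² j w (λ a b → ∑< (suc j) (λ i → G (proj₁ (cut i a)) (node (proj₂ (cut i a)) b)))
    ≡ ∑ₐ j (λ x z → M₁ x z w)
  left-part j w j≤n = begin
    𝔼 j (λ a → 𝔼 w (λ b → ∑< (suc j) (λ i → G (proj₁ (cut i a)) (node (proj₂ (cut i a)) b))))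
      ≡⟨ 𝔼-swap j w (λ a b → ∑< (suc j) (λ i → G (proj₁ (cut i a)) (node (proj₂ (cut i a)) b))) ⟩
    𝔼 w (λ b → 𝔼 j (λ a → ∑< (suc j) (λ i → G (proj₁ (cut i a)) (node (proj₂ (cut i a)) b))))
      ≡⟨ 𝔼-cong w (λ b _ → IH j j≤n (λ c d → G c (node d b))) ⟩
    𝔼 w (λ b → ∑ₐ j (λ x z → 𝔼 x (λ c → 𝔼 z (λ d → G c (node d b)))))
      ≡⟨ ∑ₐ-commute j (𝔼 w) (𝔼-+ w) (λ x z b → 𝔼 x (λ c → 𝔼 z (λ d → G c (node d b)))) ⟩
    ∑ₐ j (λ x z → 𝔼 w (λ b → 𝔼 x (λ c → 𝔼 z (λ d → G c (node d b)))))
      ≡⟨ ∑ₐ-cong j (λ x z _ → trans (𝔼-swap w x (λ b c → 𝔼 z (λ d → G c (node d b))))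
                                     (𝔼-cong x (λ c _ → 𝔼-swap w z (λ b d → G c (node d b))))) ⟩
    ∑ₐ j (λ x z → M₁ x z w) ∎
    where open ≡-Reasoning

  right-part : ∀ j w → w ≤ n →
    𝔼² j w (λ a b → ∑< (suc w) (λ i → G (node a (proj₁ (cut i b))) (proj₂ (cut i b))))
    ≡ ∑ₐ w (λ z v → M₂ j z v)
  right-part j w w≤n =
    trans (𝔼-cong j (λ a _ → IH w w≤n (λ c d → G (node a c) d)))
    (∑ₐ-commute w (𝔼 j) (𝔼-+ j) (λ z v a → 𝔼 z (λ c → 𝔼 v (λ d → G (node a c) d))))

  scaled-lhs : ℕ→ℚ (suc n) * 𝔼 (suc n) (λ t → ∑< (suc (suc n)) (λ i → G (proj₁ (cut i t)) (proj₂ (cut i t))))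
             ≡ ∑ₐ n (λ j w → ∑ₐ j (λ x z → M₁ x z w)) + ∑ₐ n (λ j w → ∑ₐ w (λ z v → M₂ j z v))
  scaled-lhs =
    trans (node-law n (IH n ℕP.≤-refl) (λ t → ∑< (suc (suc n)) (λ i → G (proj₁ (cut i t)) (proj₂ (cut i t)))))
          (trans (∑ₐ-cong n split)
                 (∑ₐ-+ n (λ j w → ∑ₐ j (λ x z → M₁ x z w)) (λ j w → ∑ₐ w (λ z v → M₂ j z v))))
    where
    split : ∀ j w → j +ℕ w ≡ n →
      𝔼 j (λ a → 𝔼 w (λ b → ∑< (suc (suc n)) (λ i → G (proj₁ (cut i (node a b))) (proj₂ (cut i (node a b))))))
      ≡ ∑ₐ j (λ x z → M₁ x z w) + ∑ₐ w (λ z v → M₂ j z v)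
    split j w j+w≡n = begin
      𝔼 j (λ a → 𝔼 w (λ b → ∑< (suc (suc n)) (λ i → G (proj₁ (cut i (node a b))) (proj₂ (cut i (node a b))))))
        ≡⟨ 𝔼-cong j inner ⟩
      𝔼 j (λ a → 𝔼 w (L a) + 𝔼 w (R a))
        ≡⟨ 𝔼-+ j (λ a → 𝔼 w (L a)) (λ a → 𝔼 w (R a)) ⟩
      𝔼 j (λ a → 𝔼 w (L a)) + 𝔼 j (λ a → 𝔼 w (R a))
        ≡⟨ cong₂ _+_ (left-part j w (subst (j ≤_) j+w≡n (ℕP.m≤m+n j w)))
                     (right-part j w (subst (w ≤_) j+w≡n (ℕP.m≤n+m w j))) ⟩
      ∑ₐ j (λ x z → M₁ x z w) + ∑ₐ w (λ z v → M₂ j z v) ∎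
      where
      open ≡-Reasoning
      L R : Tree → Tree → ℚ
      L a b = ∑< (suc j) (λ i → G (proj₁ (cut i a)) (node (proj₂ (cut i a)) b))
      R a b = ∑< (suc w) (λ i → G (node a (proj₁ (cut i b))) (proj₂ (cut i b)))
      inner : ∀ a → size a ≡ j →
        𝔼 w (λ b → ∑< (suc (suc n)) (λ i → G (proj₁ (cut i (node a b))) (proj₂ (cut i (node a b)))))
        ≡ 𝔼 w (L a) + 𝔼 w (R a)
      inner a |a| = trans (𝔼-cong w {H′ = λ b → L a b + R a b} (λ b |b| → cut-node G a b |a| |b| j+w≡n))
                          (𝔼-+ w (L a) (R a))

  scaled-rhs : ℕ→ℚ (suc n) * ∑ₐ (suc n) (λ y e → 𝔼 y (λ c → 𝔼 e (λ d → G c d)))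
             ≡ ∑ₐ n (λ y e → ∑ₐ y (λ x z → M₂ x z e)) + ∑ₐ n (λ y e → ∑ₐ e (λ z v → M₁ y z v))
  scaled-rhs = trans (∑ₐ-weighted n (λ y e → 𝔼 y (λ c → 𝔼 e (λ d → G c d))))
                     (cong₂ _+_ (∑ₐ-cong n grow-left) (∑ₐ-cong n grow-right))
    where
    grow-left : ∀ y e → y +ℕ e ≡ n →
      ℕ→ℚ (suc y) * 𝔼 (suc y) (λ c → 𝔼 e (λ d → G c d)) ≡ ∑ₐ y (λ x z → M₂ x z e)
    grow-left y e y+e≡n = node-law y (IH y (subst (y ≤_) y+e≡n (ℕP.m≤m+n y e))) (λ c → 𝔼 e (λ d → G c d))
    grow-right : ∀ y e → y +ℕ e ≡ n →
      ℕ→ℚ (suc e) * 𝔼 y (λ c → 𝔼 (suc e) (λ d → G c d)) ≡ ∑ₐ e (λ z v → M₁ y z v)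
    grow-right y e y+e≡n = begin
      ℕ→ℚ (suc e) * 𝔼 y (λ c → 𝔼 (suc e) (λ d → G c d))
        ≡⟨ 𝔼-*ˡ y (ℕ→ℚ (suc e)) (λ c → 𝔼 (suc e) (λ d → G c d)) ⟨
      𝔼 y (λ c → ℕ→ℚ (suc e) * 𝔼 (suc e) (λ d → G c d))
        ≡⟨ 𝔼-cong y (λ c _ → node-law e (IH e (subst (e ≤_) y+e≡n (ℕP.m≤n+m e y))) (G c)) ⟩
      𝔼 y (λ c → ∑ₐ e (λ z v → 𝔼 z (λ d → 𝔼 v (λ b → G c (node d b)))))
        ≡⟨ ∑ₐ-commute e (𝔼 y) (𝔼-+ y) (λ z v c → 𝔼 z (λ d → 𝔼 v (λ b → G c (node d b)))) ⟩
      ∑ₐ e (λ z v → M₁ y z v) ∎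
      where open ≡-Reasoning

cut-step : ∀ n → (∀ m → m ≤ n → CutLaw m) → CutLaw (suc n)
cut-step n IH G = *-cancelˡ-suc n (begin
  ℕ→ℚ (suc n) * 𝔼 (suc n) (λ t → ∑< (suc (suc n)) (λ i → G (proj₁ (cut i t)) (proj₂ (cut i t))))
    ≡⟨ scaled-lhs ⟩
  ∑ₐ n (λ j w → ∑ₐ j (λ x z → M₁ x z w)) + ∑ₐ n (λ j w → ∑ₐ w (λ z v → M₂ j z v))
    ≡⟨ cong₂ _+_ (∑ₐ-assoc n M₁) (sym (∑ₐ-assoc n M₂)) ⟩
  ∑ₐ n (λ y e → ∑ₐ e (λ z v → M₁ y z v)) + ∑ₐ n (λ y e → ∑ₐ y (λ x z → M₂ x z e))
    ≡⟨ ℚP.+-comm (∑ₐ n (λ y e → ∑ₐ e (λ z v → M₁ y z v))) _ ⟩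
  ∑ₐ n (λ y e → ∑ₐ y (λ x z → M₂ x z e)) + ∑ₐ n (λ y e → ∑ₐ e (λ z v → M₁ y z v))
    ≡⟨ scaled-rhs ⟨
  ℕ→ℚ (suc n) * ∑ₐ (suc n) (λ y e → 𝔼 y (λ c → 𝔼 e (λ d → G c d))) ∎)
  where
  open ≡-Reasoning
  open CutStep n IH G

𝔼-cut : ∀ n → CutLaw n
𝔼-cut = <-rec CutLaw step
  where
  step : ∀ n → (∀ {m} → m < n → CutLaw m) → CutLaw n
  step zero    _  G = trans (𝔼-zero (λ t → ∑< 1 (λ i → G (proj₁ (cut i t)) (proj₂ (cut i t)))))
                     (trans (ℚP.+-identityʳ (G nil nil)) (sym (trans (𝔼-zero (λ a → 𝔼 0 (G a))) (𝔼-zero (G nil)))))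
  step (suc n) IH   = cut-step n (λ m m≤n → IH (s≤s m≤n))

𝔼-node : ∀ n H → ℕ→ℚ (suc n) * 𝔼 (suc n) H ≡ ∑ₐ n (λ j w → 𝔼² j w (λ a b → H (node a b)))
𝔼-node n = node-law n (𝔼-cut n)

𝔼²-separable-+ : ∀ j w X Y → 𝔼² j w (λ a b → X a + Y b) ≡ 𝔼 j X + 𝔼 w Y
𝔼²-separable-+ j w X Y = begin
  𝔼 j (λ a → 𝔼 w (λ b → X a + Y b))
    ≡⟨ 𝔼-cong j (λ a _ → trans (𝔼-+ w (λ _ → X a) Y) (cong (_+ 𝔼 w Y) (𝔼-const w (X a)))) ⟩
  𝔼 j (λ a → X a + 𝔼 w Y)
    ≡⟨ 𝔼-+ j X (λ _ → 𝔼 w Y) ⟩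
  𝔼 j X + 𝔼 j (λ _ → 𝔼 w Y)
    ≡⟨ cong (_+_ (𝔼 j X)) (𝔼-const j (𝔼 w Y)) ⟩
  𝔼 j X + 𝔼 w Y ∎
  where open ≡-Reasoning

𝔼²-separable-* : ∀ j w X Y → 𝔼² j w (λ a b → X a * Y b) ≡ 𝔼 j X * 𝔼 w Y
𝔼²-separable-* j w X Y = trans (𝔼-cong j (λ a _ → 𝔼-*ˡ w (X a) Y)) (𝔼-*ʳ j (𝔼 w Y) X)

∑ₐ-𝔼²-+ : ∀ n X → ∑ₐ n (λ j w → 𝔼² j w (λ a b → X a + X b)) ≡ ℕ→ℚ 2 * ∑< (suc n) (λ m → 𝔼 m X)
∑ₐ-𝔼²-+ n X = begin
  ∑ₐ n (λ j w → 𝔼² j w (λ a b → X a + X b))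
    ≡⟨ ∑ₐ-cong n (λ j w _ → 𝔼²-separable-+ j w X X) ⟩
  ∑ₐ n (λ j w → 𝔼 j X + 𝔼 w X)
    ≡⟨ ∑ₐ-+ n (λ j w → 𝔼 j X) (λ j w → 𝔼 w X) ⟩
  ∑ₐ n (λ j w → 𝔼 j X) + ∑ₐ n (λ j w → 𝔼 w X)
    ≡⟨ cong₂ _+_ (∑ₐ-left n (λ m → 𝔼 m X)) (∑ₐ-right n (λ m → 𝔼 m X)) ⟩
  ∑< (suc n) (λ m → 𝔼 m X) + ∑< (suc n) (λ m → 𝔼 m X)
    ≡⟨ p+p≡2*p (∑< (suc n) (λ m → 𝔼 m X)) ⟩
  ℕ→ℚ 2 * ∑< (suc n) (λ m → 𝔼 m X) ∎
  where open ≡-Reasoning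

sizes-sum : ∀ {n j w} a b → size a ≡ j → size b ≡ w → j +ℕ w ≡ n → size a +ℕ size b ≡ n
sizes-sum a b refl refl j+w≡n = j+w≡n

𝔼-node-+ : ∀ n H G X → (∀ a b → size a +ℕ size b ≡ n → H (node a b) ≡ G (node a b) + (X a + X b)) →
  ℕ→ℚ (suc n) * 𝔼 (suc n) H ≡ ℕ→ℚ (suc n) * 𝔼 (suc n) G + ℕ→ℚ 2 * ∑< (suc n) (λ m → 𝔼 m X)
𝔼-node-+ n H G X H-node = begin
  ℕ→ℚ (suc n) * 𝔼 (suc n) H
    ≡⟨ 𝔼-node n H ⟩
  ∑ₐ n (λ j w → 𝔼² j w (λ a b → H (node a b)))
    ≡⟨ ∑ₐ-cong n (λ j w j+w≡n → 𝔼-cong j (λ a |a| → 𝔼-cong w (λ b |b| →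
         H-node a b (sizes-sum a b |a| |b| j+w≡n)))) ⟩
  ∑ₐ n (λ j w → 𝔼² j w (λ a b → G (node a b) + (X a + X b)))
    ≡⟨ ∑ₐ-cong n (λ j w _ → 𝔼²-+ j w (λ a b → G (node a b)) (λ a b → X a + X b)) ⟩
  ∑ₐ n (λ j w → 𝔼² j w (λ a b → G (node a b)) + 𝔼² j w (λ a b → X a + X b))
    ≡⟨ ∑ₐ-+ n (λ j w → 𝔼² j w (λ a b → G (node a b))) (λ j w → 𝔼² j w (λ a b → X a + X b)) ⟩
  ∑ₐ n (λ j w → 𝔼² j w (λ a b → G (node a b))) + ∑ₐ n (λ j w → 𝔼² j w (λ a b → X a + X b))
    ≡⟨ cong₂ _+_ (sym (𝔼-node n G)) (∑ₐ-𝔼²-+ n X) ⟩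
  ℕ→ℚ (suc n) * 𝔼 (suc n) G + ℕ→ℚ 2 * ∑< (suc n) (λ m → 𝔼 m X) ∎
  where open ≡-Reasoning

𝔼-node-≤ : ∀ n H X → (∀ a b → size a +ℕ size b ≡ n → H (node a b) ≤ℚ X a + X b) →
  ℕ→ℚ (suc n) * 𝔼 (suc n) H ≤ℚ ℕ→ℚ 2 * ∑< (suc n) (λ m → 𝔼 m X)
𝔼-node-≤ n H X H-node = begin
  ℕ→ℚ (suc n) * 𝔼 (suc n) H
    ≡⟨ 𝔼-node n H ⟩
  ∑ₐ n (λ j w → 𝔼² j w (λ a b → H (node a b)))
    ≤⟨ ∑ₐ-mono n (λ j w j+w≡n → 𝔼-mono j (λ a |a| → 𝔼-mono w (λ b |b| →
         H-node a b (sizes-sum a b |a| |b| j+w≡n)))) ⟩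
  ∑ₐ n (λ j w → 𝔼² j w (λ a b → X a + X b))
    ≡⟨ ∑ₐ-𝔼²-+ n X ⟩
  ℕ→ℚ 2 * ∑< (suc n) (λ m → 𝔼 m X) ∎
  where open ℚP.≤-Reasoning

-- The recurrences

Σ1-E : ∀ n X → X nil ≡ 0 → Σ1 n (λ m → E m X) ≡ ∑< (suc n) (λ m → 𝔼 m ⟦ X ⟧)
Σ1-E n X X-nil = begin
  Σ1 n (λ m → E m X)                        ≡⟨ Σ1-∑< n (λ m → E m X) ⟩
  ∑< n (λ i → E (suc i) X)                  ≡⟨ ∑<-cong n (λ i _ → E-𝔼 (suc i) X) ⟩
  ∑< n (λ i → 𝔼 (suc i) ⟦ X ⟧)              ≡⟨ ℚP.+-identityˡ _ ⟨
  0ℚ + ∑< n (λ i → 𝔼 (suc i) ⟦ X ⟧)         ≡⟨ cong (λ x → ℕ→ℚ x + ∑< n (λ i → 𝔼 (suc i) ⟦ X ⟧)) X-nil ⟨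
  ⟦ X ⟧ nil + ∑< n (λ i → 𝔼 (suc i) ⟦ X ⟧)  ≡⟨ cong (_+ ∑< n (λ i → 𝔼 (suc i) ⟦ X ⟧)) (𝔼-zero ⟦ X ⟧) ⟨
  ∑< (suc n) (λ m → 𝔼 m ⟦ X ⟧)              ∎
  where open ≡-Reasoning

rootPairs : ℕ → Tree → ℕ
rootPairs k t = indicator (rank t ≡ᵇ k) *ℕ leaves t

if-indicator : ∀ b x → (if b then x else 0) ≡ indicator b *ℕ x
if-indicator true  x = sym (ℕP.+-identityʳ x)
if-indicator false x = refl

pairs-node : ∀ k a b → pairs k (node a b) ≡ rootPairs k (node a b) +ℕ (pairs k a +ℕ pairs k b)
pairs-node k a b = trans (cong (λ x → x +ℕ pairs k a +ℕ pairs k b) (if-indicator _ (leaves (node a b))))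
                         (ℕP.+-assoc (rootPairs k (node a b)) (pairs k a) (pairs k b))

F-recurrence : ∀ k n → ℕ→ℚ (suc n) * F (suc n) k ≡ ℕ→ℚ 2 * Σ1 n (λ m → F m k) + ℕ→ℚ (suc n) * f (suc n) k
F-recurrence k n = begin
  ℕ→ℚ (suc n) * F (suc n) k
    ≡⟨ cong (ℕ→ℚ (suc n) *_) (E-𝔼 (suc n) (pairs k)) ⟩
  ℕ→ℚ (suc n) * 𝔼 (suc n) ⟦ pairs k ⟧
    ≡⟨ 𝔼-node-+ n ⟦ pairs k ⟧ ⟦ rootPairs k ⟧ ⟦ pairs k ⟧ cast-pairs-node ⟩
  ℕ→ℚ (suc n) * 𝔼 (suc n) ⟦ rootPairs k ⟧ + ℕ→ℚ 2 * ∑< (suc n) (λ m → 𝔼 m ⟦ pairs k ⟧)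
    ≡⟨ cong₂ (λ x y → ℕ→ℚ (suc n) * x + ℕ→ℚ 2 * y) (E-𝔼 (suc n) (rootPairs k)) (Σ1-E n (pairs k) refl) ⟨
  ℕ→ℚ (suc n) * f (suc n) k + ℕ→ℚ 2 * Σ1 n (λ m → F m k)
    ≡⟨ ℚP.+-comm (ℕ→ℚ (suc n) * f (suc n) k) _ ⟩
  ℕ→ℚ 2 * Σ1 n (λ m → F m k) + ℕ→ℚ (suc n) * f (suc n) k ∎
  where
  open ≡-Reasoning
  cast-pairs-node : ∀ a b → size a +ℕ size b ≡ n →
    ⟦ pairs k ⟧ (node a b) ≡ ⟦ rootPairs k ⟧ (node a b) + (⟦ pairs k ⟧ a + ⟦ pairs k ⟧ b)
  cast-pairs-node a b _ = trans (cong ℕ→ℚ (pairs-node k a b))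
    (trans (ℕ→ℚ-+ (rootPairs k (node a b)) _)
           (cong (_+_ (⟦ rootPairs k ⟧ (node a b))) (ℕ→ℚ-+ (pairs k a) (pairs k b))))

rootPairs≥ : ℕ → Tree → ℕ
rootPairs≥ k t = indicator (not (rank t <ᵇ k)) *ℕ leaves t

rank< : ℕ → Tree → ℕ
rank< k t = indicator (rank t <ᵇ k)

-- A missing child never lowers its parent's rank, so nil counts as deep.
deep shallow : ℕ → Tree → ℕ
deep    k nil          = 1
deep    k t@(node _ _) = indicator (not (rank t <ᵇ k))
shallow k nil          = 0
shallow k t@(node _ _) = rank< k t

deep+shallow : ∀ k t → deep k t +ℕ shallow k t ≡ 1
deep+shallow k nil          = refl
deep+shallow k t@(node _ _) with rank t <ᵇ k
... | true  = refl
... | false = refl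

rootPairs≥-deep : ∀ k t → rootPairs≥ k t ≡ deep k t *ℕ leaves t
rootPairs≥-deep k nil        = ℕP.*-zeroʳ (indicator (not (0 <ᵇ k)))
rootPairs≥-deep k (node _ _) = refl

leaves-node : ∀ {m} a b → size a +ℕ size b ≡ suc m → leaves (node a b) ≡ leaves a +ℕ leaves b
leaves-node nil          (node _ _) _ = refl
leaves-node (node _ _)   nil        _ = refl
leaves-node (node _ _)   (node _ _) _ = refl

⊓-<ᵇ : ∀ x y k → (x ⊓ y <ᵇ k) ≡ (x <ᵇ k) ∨ (y <ᵇ k)
⊓-<ᵇ x       y       zero    = refl
⊓-<ᵇ zero    y       (suc k) = refl
⊓-<ᵇ (suc x) zero    (suc k) = sym (∨-zeroʳ (x <ᵇ k))
⊓-<ᵇ (suc x) (suc y) (suc k) = ⊓-<ᵇ x y k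

indicator-not-∨ : ∀ a b → indicator (not (a ∨ b)) ≡ indicator (not a) *ℕ indicator (not b)
indicator-not-∨ false b = sym (ℕP.+-identityʳ _)
indicator-not-∨ true  b = refl

indicator-∨ : ∀ a b → indicator (a ∨ b) ≤ indicator a +ℕ indicator b
indicator-∨ true  b = s≤s z≤n
indicator-∨ false b = ℕP.≤-refl

deep-node : ∀ {m} k a b → size a +ℕ size b ≡ suc m → deep (suc k) (node a b) ≡ deep k a *ℕ deep k b
deep-node k nil          (node _ _)   _ = sym (ℕP.*-identityˡ _)
deep-node k (node _ _)   nil          _ = sym (ℕP.*-identityʳ _)
deep-node k a@(node _ _) b@(node _ _) _ = trans (cong (λ x → indicator (not x)) (⊓-<ᵇ (rank a) (rank b) k))
                                                (indicator-not-∨ (rank a <ᵇ k) (rank b <ᵇ k))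

shallow-node : ∀ {m} k a b → size a +ℕ size b ≡ suc m → shallow (suc k) (node a b) ≤ shallow k a +ℕ shallow k b
shallow-node k nil          (node _ _)   _ = ℕP.≤-refl
shallow-node k (node _ _)   nil          _ = ℕP.m≤m+n _ 0
shallow-node k a@(node _ _) b@(node _ _) _ =
  subst (_≤ shallow k a +ℕ shallow k b) (cong indicator (sym (⊓-<ᵇ (rank a) (rank b) k)))
        (indicator-∨ (rank a <ᵇ k) (rank b <ᵇ k))

rootPairs≥-node : ∀ {m} k a b → size a +ℕ size b ≡ suc m →
  rootPairs≥ (suc k) (node a b) ≡ rootPairs≥ k a *ℕ deep k b +ℕ deep k a *ℕ rootPairs≥ k b
rootPairs≥-node k a b ab = begin
  rootPairs≥ (suc k) (node a b)                     ≡⟨ rootPairs≥-deep (suc k) (node a b) ⟩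
  deep (suc k) (node a b) *ℕ leaves (node a b)      ≡⟨ cong₂ _*ℕ_ (deep-node k a b ab) (leaves-node a b ab) ⟩
  deep k a *ℕ deep k b *ℕ (leaves a +ℕ leaves b)    ≡⟨ distribute (deep k a) (deep k b) (leaves a) (leaves b) ⟩
  deep k a *ℕ leaves a *ℕ deep k b +ℕ deep k a *ℕ (deep k b *ℕ leaves b)
    ≡⟨ cong₂ (λ x y → x *ℕ deep k b +ℕ deep k a *ℕ y) (rootPairs≥-deep k a) (rootPairs≥-deep k b) ⟨
  rootPairs≥ k a *ℕ deep k b +ℕ deep k a *ℕ rootPairs≥ k b ∎
  where
  open ≡-Reasoning
  distribute : ∀ x y u v → x *ℕ y *ℕ (u +ℕ v) ≡ x *ℕ u *ℕ y +ℕ x *ℕ (y *ℕ v)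
  distribute = solve-∀

𝔼-deep+shallow : ∀ k j → 𝔼 j ⟦ deep k ⟧ + 𝔼 j ⟦ shallow k ⟧ ≡ 1ℚ
𝔼-deep+shallow k j = begin
  𝔼 j ⟦ deep k ⟧ + 𝔼 j ⟦ shallow k ⟧
    ≡⟨ 𝔼-+ j ⟦ deep k ⟧ ⟦ shallow k ⟧ ⟨
  𝔼 j (λ t → ⟦ deep k ⟧ t + ⟦ shallow k ⟧ t)
    ≡⟨ 𝔼-cong j (λ t _ → trans (sym (ℕ→ℚ-+ (deep k t) _)) (cong ℕ→ℚ (deep+shallow k t))) ⟩
  𝔼 j (λ _ → 1ℚ)
    ≡⟨ 𝔼-const j 1ℚ ⟩
  1ℚ ∎
  where open ≡-Reasoning

𝔼-shallow : ∀ k j → 𝔼 (suc j) ⟦ shallow k ⟧ ≡ pLt (suc j) k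
𝔼-shallow k j = trans (𝔼-cong (suc j) node-only) (sym (E-𝔼 (suc j) (rank< k)))
  where
  node-only : ∀ t → size t ≡ suc j → ⟦ shallow k ⟧ t ≡ ⟦ rank< k ⟧ t
  node-only (node _ _) _ = refl

𝔼²-rootPairs≥-node : ∀ k {m} j w → j +ℕ w ≡ suc m →
  𝔼² j w (λ a b → ⟦ rootPairs≥ (suc k) ⟧ (node a b))
  ≡ 𝔼 j ⟦ rootPairs≥ k ⟧ * 𝔼 w ⟦ deep k ⟧ + 𝔼 j ⟦ deep k ⟧ * 𝔼 w ⟦ rootPairs≥ k ⟧
𝔼²-rootPairs≥-node k {m} j w j+w≡ = begin
  𝔼² j w (λ a b → ⟦ rootPairs≥ (suc k) ⟧ (node a b))
    ≡⟨ 𝔼-cong j (λ a |a| → 𝔼-cong w (λ b |b| → cast-node a b (sizes-sum a b |a| |b| j+w≡))) ⟩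
  𝔼² j w (λ a b → X a * Y b + Y a * X b)
    ≡⟨ 𝔼²-+ j w (λ a b → X a * Y b) (λ a b → Y a * X b) ⟩
  𝔼² j w (λ a b → X a * Y b) + 𝔼² j w (λ a b → Y a * X b)
    ≡⟨ cong₂ _+_ (𝔼²-separable-* j w X Y) (𝔼²-separable-* j w Y X) ⟩
  𝔼 j X * 𝔼 w Y + 𝔼 j Y * 𝔼 w X ∎
  where
  open ≡-Reasoning
  X = ⟦ rootPairs≥ k ⟧
  Y = ⟦ deep k ⟧
  cast-node : ∀ a b → size a +ℕ size b ≡ suc m → ⟦ rootPairs≥ (suc k) ⟧ (node a b) ≡ X a * Y b + Y a * X b
  cast-node a b ab = trans (cong ℕ→ℚ (rootPairs≥-node k a b ab))
    (trans (ℕ→ℚ-+ (rootPairs≥ k a *ℕ deep k b) _)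
           (cong₂ _+_ (ℕ→ℚ-* (rootPairs≥ k a) (deep k b)) (ℕ→ℚ-* (deep k a) (rootPairs≥ k b))))

fGe-recurrence : ∀ k n → ℕ→ℚ (suc n) * fGe (suc n) (suc k)
               ≡ ℕ→ℚ 2 * (Σ1 n (λ m → fGe m k) - Σ1 (n ∸ 1) (λ i → pLt i k * fGe (n ∸ i) k))
fGe-recurrence k zero    = refl
fGe-recurrence k (suc m) = begin
  ℕ→ℚ (suc n) * fGe (suc n) (suc k)
    ≡⟨ cong (ℕ→ℚ (suc n) *_) (E-𝔼 (suc n) (rootPairs≥ (suc k))) ⟩
  ℕ→ℚ (suc n) * 𝔼 (suc n) ⟦ rootPairs≥ (suc k) ⟧
    ≡⟨ 𝔼-node n ⟦ rootPairs≥ (suc k) ⟧ ⟩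
  ∑ₐ n (λ j w → 𝔼² j w (λ a b → ⟦ rootPairs≥ (suc k) ⟧ (node a b)))
    ≡⟨ ∑ₐ-cong n (𝔼²-rootPairs≥-node k) ⟩
  ∑ₐ n (λ j w → G j * q w + q j * G w)
    ≡⟨ ∑ₐ-+ n (λ j w → G j * q w) (λ j w → q j * G w) ⟩
  ∑ₐ n (λ j w → G j * q w) + D
    ≡⟨ cong (_+ D) (trans (∑ₐ-swap n (λ j w → G j * q w)) (∑ₐ-cong n (λ j w _ → ℚP.*-comm (G w) (q j)))) ⟩
  D + D
    ≡⟨ p+p≡2*p D ⟩
  ℕ→ℚ 2 * D
    ≡⟨ cong (ℕ→ℚ 2 *_) (∑ₐ-complement n q r G (𝔼-deep+shallow k)) ⟩
  ℕ→ℚ 2 * (∑ₐ n (λ j w → G w) - ∑ₐ n (λ j w → r j * G w))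
    ≡⟨ cong₂ (λ x y → ℕ→ℚ 2 * (x - y)) all-terms shallow-terms ⟩
  ℕ→ℚ 2 * (Σ1 n (λ i → fGe i k) - Σ1 m (λ i → pLt i k * fGe (n ∸ i) k)) ∎
  where
  open ≡-Reasoning
  n = suc m
  G q r : ℕ → ℚ
  G j = 𝔼 j ⟦ rootPairs≥ k ⟧
  q j = 𝔼 j ⟦ deep k ⟧
  r j = 𝔼 j ⟦ shallow k ⟧
  D = ∑ₐ n (λ j w → q j * G w)
  G≡fGe : ∀ i → G i ≡ fGe i k
  G≡fGe i = sym (E-𝔼 i (rootPairs≥ k))
  G0 : G 0 ≡ 0ℚ
  G0 = trans (𝔼-zero ⟦ rootPairs≥ k ⟧) (cong ℕ→ℚ (rootPairs≥-deep k nil))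
  all-terms : ∑ₐ n (λ j w → G w) ≡ Σ1 n (λ i → fGe i k)
  all-terms = trans (∑ₐ-right n G) (sym (Σ1-E n (rootPairs≥ k) (rootPairs≥-deep k nil)))
  shallow-terms : ∑ₐ n (λ j w → r j * G w) ≡ Σ1 m (λ i → pLt i k * fGe (n ∸ i) k)
  shallow-terms = begin
    ∑ₐ n (λ j w → r j * G w)
      ≡⟨ ∑ₐ-inner m r G (𝔼-zero ⟦ shallow k ⟧) G0 ⟩
    ∑< m (λ j → r (suc j) * G (m ∸ j))
      ≡⟨ ∑<-cong m (λ j _ → cong₂ _*_ (𝔼-shallow k j) (G≡fGe (m ∸ j))) ⟩
    ∑< m (λ j → pLt (suc j) k * fGe (m ∸ j) k)
      ≡⟨ Σ1-∑< m (λ i → pLt i k * fGe (n ∸ i) k) ⟨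
    Σ1 m (λ i → pLt i k * fGe (n ∸ i) k) ∎

fGe-zero : ∀ n → fGe n 0 ≡ EL n
fGe-zero n = E-cong n (λ t → ℕP.*-identityˡ (leaves t))

EL-recurrence : ∀ m → ℕ→ℚ (suc (suc m)) * EL (suc (suc m)) ≡ ℕ→ℚ 2 * Σ1 (suc m) EL
EL-recurrence m = begin
  ℕ→ℚ (suc n) * EL (suc n)
    ≡⟨ cong (ℕ→ℚ (suc n) *_) (E-𝔼 (suc n) leaves) ⟩
  ℕ→ℚ (suc n) * 𝔼 (suc n) ⟦ leaves ⟧
    ≡⟨ 𝔼-node-+ n ⟦ leaves ⟧ (λ _ → 0ℚ) ⟦ leaves ⟧ cast-leaves-node ⟩
  ℕ→ℚ (suc n) * 𝔼 (suc n) (λ _ → 0ℚ) + ℕ→ℚ 2 * ∑< (suc n) (λ j → 𝔼 j ⟦ leaves ⟧)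
    ≡⟨ cong₂ (λ x y → ℕ→ℚ (suc n) * x + ℕ→ℚ 2 * y) (𝔼-0 (suc n)) (sym (Σ1-E n leaves refl)) ⟩
  ℕ→ℚ (suc n) * 0ℚ + ℕ→ℚ 2 * Σ1 n EL
    ≡⟨ cong (_+ ℕ→ℚ 2 * Σ1 n EL) (ℚP.*-zeroʳ (ℕ→ℚ (suc n))) ⟩
  0ℚ + ℕ→ℚ 2 * Σ1 n EL
    ≡⟨ ℚP.+-identityˡ _ ⟩
  ℕ→ℚ 2 * Σ1 n EL ∎
  where
  open ≡-Reasoning
  n = suc m
  cast-leaves-node : ∀ a b → size a +ℕ size b ≡ n →
                     ⟦ leaves ⟧ (node a b) ≡ 0ℚ + (⟦ leaves ⟧ a + ⟦ leaves ⟧ b)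
  cast-leaves-node a b ab = trans (cong ℕ→ℚ (leaves-node a b ab))
                                  (trans (ℕ→ℚ-+ (leaves a) (leaves b)) (sym (ℚP.+-identityˡ _)))

Σ1-EL : ∀ n → Σ1 (suc n) EL ≡ ℕ→ℚ (2 +ℕ n) * ℕ→ℚ (3 +ℕ n) * (+ 1 / 6)

EL-closed : ∀ n → EL (suc (suc n)) ≡ ℕ→ℚ (3 +ℕ n) * (+ 1 / 3)
EL-closed n = *-cancelˡ-suc (suc n) (begin
  ℕ→ℚ (2 +ℕ n) * EL (2 +ℕ n)                      ≡⟨ EL-recurrence n ⟩
  ℕ→ℚ 2 * Σ1 (suc n) EL                           ≡⟨ cong (ℕ→ℚ 2 *_) (Σ1-EL n) ⟩
  ℕ→ℚ 2 * (ℕ→ℚ (2 +ℕ n) * ℕ→ℚ (3 +ℕ n) * (+ 1 / 6))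
    ≡⟨ cong₂ (λ a b → ℕ→ℚ 2 * (a * b * (+ 1 / 6))) (ℕ→ℚ-+ 2 n) (ℕ→ℚ-+ 3 n) ⟩
  ℕ→ℚ 2 * ((ℕ→ℚ 2 + x) * (ℕ→ℚ 3 + x) * (+ 1 / 6)) ≡⟨ identity x ⟩
  (ℕ→ℚ 2 + x) * ((ℕ→ℚ 3 + x) * (+ 1 / 3))
    ≡⟨ cong₂ (λ a b → a * (b * (+ 1 / 3))) (ℕ→ℚ-+ 2 n) (ℕ→ℚ-+ 3 n) ⟨
  ℕ→ℚ (2 +ℕ n) * (ℕ→ℚ (3 +ℕ n) * (+ 1 / 3))      ∎)
  where
  open ≡-Reasoning
  x = ℕ→ℚ n
  identity : ∀ x → ℕ→ℚ 2 * ((ℕ→ℚ 2 + x) * (ℕ→ℚ 3 + x) * (+ 1 / 6))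
                 ≡ (ℕ→ℚ 2 + x) * ((ℕ→ℚ 3 + x) * (+ 1 / 3))
  identity = solve 1 (λ x → con (ℕ→ℚ 2) :* ((con (ℕ→ℚ 2) :+ x) :* (con (ℕ→ℚ 3) :+ x) :* con (+ 1 / 6))
                          := (con (ℕ→ℚ 2) :+ x) :* ((con (ℕ→ℚ 3) :+ x) :* con (+ 1 / 3))) refl

Σ1-EL zero    = refl
Σ1-EL (suc n) = begin
  Σ1 (suc (suc n)) EL                                             ≡⟨ Σ1-snoc (suc n) EL ⟩
  Σ1 (suc n) EL + EL (suc (suc n))                                ≡⟨ cong₂ _+_ (Σ1-EL n) (EL-closed n) ⟩
  ℕ→ℚ (2 +ℕ n) * ℕ→ℚ (3 +ℕ n) * (+ 1 / 6) + ℕ→ℚ (3 +ℕ n) * (+ 1 / 3)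
    ≡⟨ cong₂ (λ a b → a * b * (+ 1 / 6) + b * (+ 1 / 3)) (ℕ→ℚ-+ 2 n) (ℕ→ℚ-+ 3 n) ⟩
  (ℕ→ℚ 2 + x) * (ℕ→ℚ 3 + x) * (+ 1 / 6) + (ℕ→ℚ 3 + x) * (+ 1 / 3) ≡⟨ identity x ⟩
  (ℕ→ℚ 3 + x) * (ℕ→ℚ 4 + x) * (+ 1 / 6)
    ≡⟨ cong₂ (λ a b → a * b * (+ 1 / 6)) (ℕ→ℚ-+ 3 n) (ℕ→ℚ-+ 4 n) ⟨
  ℕ→ℚ (3 +ℕ n) * ℕ→ℚ (4 +ℕ n) * (+ 1 / 6)                        ∎
  where
  open ≡-Reasoning
  x = ℕ→ℚ n
  identity : ∀ x → (ℕ→ℚ 2 + x) * (ℕ→ℚ 3 + x) * (+ 1 / 6) + (ℕ→ℚ 3 + x) * (+ 1 / 3)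
                 ≡ (ℕ→ℚ 3 + x) * (ℕ→ℚ 4 + x) * (+ 1 / 6)
  identity = solve 1 (λ x → (con (ℕ→ℚ 2) :+ x) :* (con (ℕ→ℚ 3) :+ x) :* con (+ 1 / 6)
                             :+ (con (ℕ→ℚ 3) :+ x) :* con (+ 1 / 3)
                          := (con (ℕ→ℚ 3) :+ x) :* (con (ℕ→ℚ 4) :+ x) :* con (+ 1 / 6)) refl

-- Rank bounds and the limit

-- central m = C(2m, m) / 4^m, of order 1/√m.
central : ℕ → ℚ
central zero    = 1ℚ
central (suc m) = central m * (+ suc (2 *ℕ m) / (2 *ℕ suc m))

central-step : ∀ m → ℕ→ℚ (2 *ℕ suc m) * central (suc m) ≡ ℕ→ℚ (suc (2 *ℕ m)) * central m
central-step m = begin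
  D * (central m * (+ suc (2 *ℕ m) / (2 *ℕ suc m)))
    ≡⟨ cong (λ x → D * (central m * x)) (/≡*1/ (suc (2 *ℕ m)) (2 *ℕ suc m)) ⟩
  D * (central m * (A * (+ 1 / (2 *ℕ suc m))))
    ≡⟨ regroup D (central m) A (+ 1 / (2 *ℕ suc m)) ⟩
  D * (+ 1 / (2 *ℕ suc m)) * (A * central m)
    ≡⟨ cong (_* (A * central m)) (*-1/ (2 *ℕ suc m)) ⟩
  1ℚ * (A * central m)
    ≡⟨ ℚP.*-identityˡ _ ⟩
  A * central m ∎
  where
  open ≡-Reasoning
  D = ℕ→ℚ (2 *ℕ suc m)
  A = ℕ→ℚ (suc (2 *ℕ m))
  regroup : ∀ d c a i → d * (c * (a * i)) ≡ d * i * (a * c)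
  regroup = solve 4 (λ d c a i → d :* (c :* (a :* i)) := d :* i :* (a :* c)) refl

central-nonneg : ∀ m → 0ℚ ≤ℚ central m
central-nonneg zero    = ℚP.nonNegative⁻¹ 1ℚ
central-nonneg (suc m) = *-nonneg (central-nonneg m) (/-nonneg (suc (2 *ℕ m)) (2 *ℕ suc m))

central-suc-≤ : ∀ m → central (suc m) ≤ℚ central m
central-suc-≤ m = begin
  central m * (+ suc (2 *ℕ m) / (2 *ℕ suc m))
    ≡⟨ cong (central m *_) (/≡*1/ (suc (2 *ℕ m)) (2 *ℕ suc m)) ⟩
  central m * (ℕ→ℚ (suc (2 *ℕ m)) * (+ 1 / (2 *ℕ suc m)))
    ≤⟨ *-monoˡ-≤ (central m) (central-nonneg m) (*-monoʳ-≤ _ (/-nonneg 1 (2 *ℕ suc m)) (ℕ→ℚ-mono a≤d)) ⟩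
  central m * (ℕ→ℚ (2 *ℕ suc m) * (+ 1 / (2 *ℕ suc m)))
    ≡⟨ cong (central m *_) (*-1/ (2 *ℕ suc m)) ⟩
  central m * 1ℚ
    ≡⟨ ℚP.*-identityʳ (central m) ⟩
  central m ∎
  where
  open ℚP.≤-Reasoning
  a≤d : suc (2 *ℕ m) ≤ 2 *ℕ suc m
  a≤d = subst (suc (2 *ℕ m) ≤_) (sym (ℕP.*-suc 2 m)) (ℕP.n≤1+n _)

central-anti : ∀ {N n} → N ≤ n → central n ≤ℚ central N
central-anti N≤n = go (ℕP.≤⇒≤′ N≤n)
  where
  go : ∀ {N n} → N ℕ.≤′ n → central n ≤ℚ central N
  go ℕ.≤′-refl                  = ℚP.≤-refl
  go (ℕ.≤′-step {n = n} N≤′n) = ℚP.≤-trans (central-suc-≤ n) (go N≤′n)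

∑<-central : ∀ m → ∑< m central ≡ ℕ→ℚ (2 *ℕ m) * central m
∑<-central zero    = sym (ℚP.*-zeroˡ 1ℚ)
∑<-central (suc m) = begin
  ∑< (suc m) central
    ≡⟨ ∑<-snoc m central ⟩
  ∑< m central + central m
    ≡⟨ cong (_+ central m) (∑<-central m) ⟩
  ℕ→ℚ (2 *ℕ m) * central m + central m
    ≡⟨ cong (_+_ (ℕ→ℚ (2 *ℕ m) * central m)) (ℚP.*-identityˡ (central m)) ⟨
  ℕ→ℚ (2 *ℕ m) * central m + 1ℚ * central m
    ≡⟨ ℚP.*-distribʳ-+ (central m) (ℕ→ℚ (2 *ℕ m)) 1ℚ ⟨
  (ℕ→ℚ (2 *ℕ m) + 1ℚ) * central m
    ≡⟨ cong (_* central m) (ℕ→ℚ-suc (2 *ℕ m)) ⟨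
  ℕ→ℚ (suc (2 *ℕ m)) * central m
    ≡⟨ central-step m ⟨
  ℕ→ℚ (2 *ℕ suc m) * central (suc m) ∎
  where open ≡-Reasoning

central-telescope : ∀ m → central m * (+ 1 / suc m) ≡ ℕ→ℚ 2 * (central m - central (suc m))
central-telescope m = begin
  c * i                               ≡⟨ cong (_* i) (peel A c) ⟩
  ((A + 1ℚ) * c - A * c) * i          ≡⟨ cong (λ x → (x * c - A * c) * i) (ℕ→ℚ-2*suc m) ⟨
  (D * c - A * c) * i                 ≡⟨ cong (λ x → (D * c - x) * i) (central-step m) ⟨
  (D * c - D * c′) * i                ≡⟨ cong (λ x → (x * c - x * c′) * i) (ℕ→ℚ-* 2 (suc m)) ⟩
  (two * s * c - two * s * c′) * i    ≡⟨ regroup two s c c′ i ⟩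
  two * (c - c′) * (s * i)            ≡⟨ cong (two * (c - c′) *_) (*-1/ (suc m)) ⟩
  two * (c - c′) * 1ℚ                 ≡⟨ ℚP.*-identityʳ _ ⟩
  two * (c - c′)                      ∎
  where
  open ≡-Reasoning
  c = central m
  c′ = central (suc m)
  i = + 1 / suc m
  s = ℕ→ℚ (suc m)
  two = ℕ→ℚ 2
  A = ℕ→ℚ (suc (2 *ℕ m))
  D = ℕ→ℚ (2 *ℕ suc m)
  peel : ∀ a c → c ≡ (a + 1ℚ) * c - a * c
  peel = solve 2 (λ a c → c := (a :+ con 1ℚ) :* c :- a :* c) refl
  regroup : ∀ t s c c′ i → (t * s * c - t * s * c′) * i ≡ t * (c - c′) * (s * i)
  regroup = solve 5 (λ t s c c′ i → (t :* s :* c :- t :* s :* c′) :* i := t :* (c :- c′) :* (s :* i)) refl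

central-sq : ∀ m → central m * central m * ℕ→ℚ (suc (2 *ℕ m)) ≤ℚ 1ℚ
central-sq zero    = ℚP.≤-refl
central-sq (suc m) = ℚP.*-cancelˡ-≤-pos (D * D) {{D²-pos}} (begin
  D * D * (c′ * c′ * A′)
    ≡⟨ regroup D c′ A′ ⟩
  (D * c′) * (D * c′) * A′
    ≡⟨ cong (λ x → x * x * A′) (central-step m) ⟩
  (A * c) * (A * c) * A′
    ≡⟨ regroup′ A c A′ ⟩
  (c * c * A) * (A * A′)
    ≤⟨ *-monoʳ-≤ (A * A′) (*-nonneg (ℕ→ℚ-nonneg (suc (2 *ℕ m))) (ℕ→ℚ-nonneg (suc (2 *ℕ suc m))))
                 (central-sq m) ⟩
  1ℚ * (A * A′)
    ≡⟨ ℚP.*-identityˡ _ ⟩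
  A * A′
    ≡⟨ cong (A *_) A′≡ ⟩
  A * (A + 1ℚ + 1ℚ)
    ≤⟨ p≤p+q (ℚP.nonNegative⁻¹ 1ℚ) ⟩
  A * (A + 1ℚ + 1ℚ) + 1ℚ
    ≡⟨ square A ⟩
  (A + 1ℚ) * (A + 1ℚ)
    ≡⟨ cong (λ x → x * x) (ℕ→ℚ-2*suc m) ⟨
  D * D
    ≡⟨ ℚP.*-identityʳ _ ⟨
  D * D * 1ℚ ∎)
  where
  open ℚP.≤-Reasoning
  c = central m
  c′ = central (suc m)
  A = ℕ→ℚ (suc (2 *ℕ m))
  A′ = ℕ→ℚ (suc (2 *ℕ suc m))
  D = ℕ→ℚ (2 *ℕ suc m)
  A′≡ : A′ ≡ A + 1ℚ + 1ℚ
  A′≡ = trans (ℕ→ℚ-suc (2 *ℕ suc m)) (cong (_+ 1ℚ) (ℕ→ℚ-2*suc m))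
  D²-pos : ℚ.Positive (D * D)
  D²-pos = ℚP.pos*pos⇒pos D {{ℕ→ℚ-pos (m +ℕ 1 *ℕ suc m)}} D {{ℕ→ℚ-pos (m +ℕ 1 *ℕ suc m)}}
  regroup : ∀ d c a → d * d * (c * c * a) ≡ (d * c) * (d * c) * a
  regroup = solve 3 (λ d c a → d :* d :* (c :* c :* a) := (d :* c) :* (d :* c) :* a) refl
  regroup′ : ∀ a c a′ → (a * c) * (a * c) * a′ ≡ (c * c * a) * (a * a′)
  regroup′ = solve 3 (λ a c a′ → (a :* c) :* (a :* c) :* a′ := (c :* c :* a) :* (a :* a′)) refl
  square : ∀ a → a * (a + 1ℚ + 1ℚ) + 1ℚ ≡ (a + 1ℚ) * (a + 1ℚ)
  square = solve 1 (λ a → a :* (a :+ con 1ℚ :+ con 1ℚ) :+ con 1ℚ := (a :+ con 1ℚ) :* (a :+ con 1ℚ)) refl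

central-lower : ∀ m → 1ℚ ≤ℚ ℕ→ℚ (suc m) * central m
central-lower zero    = ℚP.≤-refl
central-lower (suc m) = ℚP.*-cancelˡ-≤-pos D {{ℕ→ℚ-pos (m +ℕ 1 *ℕ suc m)}} (begin
  D * 1ℚ                                   ≤⟨ *-monoˡ-≤ D (ℕ→ℚ-nonneg (2 *ℕ suc m)) (central-lower m) ⟩
  D * (s * c)                              ≡⟨ ℚP.*-assoc D s c ⟨
  D * s * c                                ≤⟨ *-monoʳ-≤ c (central-nonneg m) grow ⟩
  s′ * A * c                               ≡⟨ ℚP.*-assoc s′ A c ⟩
  s′ * (A * c)                             ≡⟨ cong (s′ *_) (central-step m) ⟨
  s′ * (D * c′)                            ≡⟨ swap s′ D c′ ⟩
  D * (s′ * c′)                            ∎)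
  where
  open ℚP.≤-Reasoning
  c = central m
  c′ = central (suc m)
  s = ℕ→ℚ (suc m)
  s′ = ℕ→ℚ (suc (suc m))
  A = ℕ→ℚ (suc (2 *ℕ m))
  D = ℕ→ℚ (2 *ℕ suc m)
  expand : ∀ m → 2 *ℕ suc m *ℕ suc m +ℕ m ≡ suc (suc m) *ℕ suc (2 *ℕ m)
  expand = solve-∀
  grow : D * s ≤ℚ s′ * A
  grow = subst₂ _≤ℚ_ (ℕ→ℚ-* (2 *ℕ suc m) (suc m)) (ℕ→ℚ-* (suc (suc m)) (suc (2 *ℕ m)))
           (ℕ→ℚ-mono (subst (2 *ℕ suc m *ℕ suc m ≤_) (expand m) (ℕP.m≤m+n _ m)))
  swap : ∀ x y z → x * (y * z) ≡ y * (x * z)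
  swap = solve 3 (λ x y z → x :* (y :* z) := y :* (x :* z)) refl

1/suc≤central : ∀ m → + 1 / suc m ≤ℚ central m
1/suc≤central m = begin
  + 1 / suc m
    ≡⟨ ℚP.*-identityʳ _ ⟨
  + 1 / suc m * 1ℚ
    ≤⟨ *-monoˡ-≤ (+ 1 / suc m) (/-nonneg 1 (suc m)) (central-lower m) ⟩
  + 1 / suc m * (ℕ→ℚ (suc m) * central m)
    ≡⟨ ℚP.*-assoc (+ 1 / suc m) _ _ ⟨
  + 1 / suc m * ℕ→ℚ (suc m) * central m
    ≡⟨ cong (_* central m) (trans (ℚP.*-comm (+ 1 / suc m) _) (*-1/ (suc m))) ⟩
  1ℚ * central m
    ≡⟨ ℚP.*-identityˡ (central m) ⟩
  central m ∎
  where open ℚP.≤-Reasoning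

pLt-zero : ∀ n → pLt n 0 ≡ 0ℚ
pLt-zero n = trans (E-𝔼 n (λ _ → 0)) (𝔼-0 n)

Σ1-pLt : ∀ k n → Σ1 n (λ j → pLt j k) ≡ ∑< (suc n) (λ j → 𝔼 j ⟦ shallow k ⟧)
Σ1-pLt k n = begin
  Σ1 n (λ j → pLt j k)
    ≡⟨ Σ1-∑< n (λ j → pLt j k) ⟩
  ∑< n (λ i → pLt (suc i) k)
    ≡⟨ ∑<-cong n (λ i _ → 𝔼-shallow k i) ⟨
  ∑< n (λ i → 𝔼 (suc i) ⟦ shallow k ⟧)
    ≡⟨ ℚP.+-identityˡ _ ⟨
  0ℚ + ∑< n (λ i → 𝔼 (suc i) ⟦ shallow k ⟧)
    ≡⟨ cong (_+ ∑< n (λ i → 𝔼 (suc i) ⟦ shallow k ⟧)) (𝔼-zero ⟦ shallow k ⟧) ⟨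
  ∑< (suc n) (λ j → 𝔼 j ⟦ shallow k ⟧) ∎
  where open ≡-Reasoning

pLt-recurrence : ∀ k m → ℕ→ℚ (suc (suc m)) * pLt (suc (suc m)) (suc k) ≤ℚ ℕ→ℚ 2 * Σ1 (suc m) (λ j → pLt j k)
pLt-recurrence k m = begin
  ℕ→ℚ (suc n) * pLt (suc n) (suc k)
    ≡⟨ cong (ℕ→ℚ (suc n) *_) (𝔼-shallow (suc k) n) ⟨
  ℕ→ℚ (suc n) * 𝔼 (suc n) ⟦ shallow (suc k) ⟧
    ≤⟨ 𝔼-node-≤ n ⟦ shallow (suc k) ⟧ ⟦ shallow k ⟧ cast-shallow-node ⟩
  ℕ→ℚ 2 * ∑< (suc n) (λ j → 𝔼 j ⟦ shallow k ⟧)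
    ≡⟨ cong (ℕ→ℚ 2 *_) (Σ1-pLt k n) ⟨
  ℕ→ℚ 2 * Σ1 n (λ j → pLt j k) ∎
  where
  open ℚP.≤-Reasoning
  n = suc m
  cast-shallow-node : ∀ a b → size a +ℕ size b ≡ n →
                      ⟦ shallow (suc k) ⟧ (node a b) ≤ℚ ⟦ shallow k ⟧ a + ⟦ shallow k ⟧ b
  cast-shallow-node a b ab = subst (⟦ shallow (suc k) ⟧ (node a b) ≤ℚ_) (ℕ→ℚ-+ (shallow k a) (shallow k b))
                                   (ℕ→ℚ-mono (shallow-node k a b ab))

pLt-bound : ∀ k m → pLt (suc m) k ≤ℚ ℕ→ℚ (4 ^ k) * central (suc m)
pLt-bound zero    m       = subst (_≤ℚ ℕ→ℚ 1 * central (suc m)) (sym (pLt-zero (suc m)))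
                                  (*-nonneg (ℕ→ℚ-nonneg 1) (central-nonneg (suc m)))
pLt-bound (suc k) zero    = begin
  -- T [ 1 ] is a single leaf, of rank 0 < suc k, and central 1 = 1/2.
  pLt 1 (suc k)                        ≡⟨ refl ⟩
  ℕ→ℚ 2 * central 1                    ≤⟨ *-monoʳ-≤ (central 1) (central-nonneg 1) (ℕ→ℚ-mono 2≤4^) ⟩
  ℕ→ℚ (4 ^ suc k) * central 1          ∎
  where
  open ℚP.≤-Reasoning
  2≤4^ : 2 ≤ 4 ^ suc k
  2≤4^ = ℕP.*-mono-≤ {2} {4} (s≤s (s≤s z≤n)) (ℕP.m^n>0 4 k)
pLt-bound (suc k) (suc m) = ℚP.*-cancelˡ-≤-pos s {{ℕ→ℚ-pos (suc m)}} (begin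
  s * pLt (suc (suc m)) (suc k)
    ≤⟨ pLt-recurrence k m ⟩
  ℕ→ℚ 2 * Σ1 (suc m) (λ j → pLt j k)
    ≡⟨ cong (ℕ→ℚ 2 *_) (Σ1-∑< (suc m) (λ j → pLt j k)) ⟩
  ℕ→ℚ 2 * ∑< (suc m) (λ i → pLt (suc i) k)
    ≤⟨ *-monoˡ-≤ (ℕ→ℚ 2) (ℕ→ℚ-nonneg 2) (∑<-mono (suc m) (λ i _ → pLt-bound k i)) ⟩
  ℕ→ℚ 2 * ∑< (suc m) (λ i → K * central (suc i))
    ≡⟨ cong (ℕ→ℚ 2 *_) (∑<-*ˡ (suc m) K (λ i → central (suc i))) ⟩
  ℕ→ℚ 2 * (K * ∑< (suc m) (λ i → central (suc i)))
    ≤⟨ *-monoˡ-≤ (ℕ→ℚ 2) (ℕ→ℚ-nonneg 2) (*-monoˡ-≤ K (ℕ→ℚ-nonneg (4 ^ k)) (p≤q+p (central-nonneg 0))) ⟩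
  ℕ→ℚ 2 * (K * ∑< (suc (suc m)) central)
    ≡⟨ cong (λ x → ℕ→ℚ 2 * (K * x)) (∑<-central (suc (suc m))) ⟩
  ℕ→ℚ 2 * (K * (ℕ→ℚ (2 *ℕ suc (suc m)) * c))
    ≡⟨ cong (λ x → ℕ→ℚ 2 * (K * (x * c))) (ℕ→ℚ-* 2 (suc (suc m))) ⟩
  ℕ→ℚ 2 * (K * (ℕ→ℚ 2 * s * c))
    ≡⟨ regroup K s c ⟩
  s * (ℕ→ℚ 4 * K * c)
    ≡⟨ cong (λ x → s * (x * c)) (ℕ→ℚ-* 4 (4 ^ k)) ⟨
  s * (ℕ→ℚ (4 ^ suc k) * c) ∎)
  where
  open ℚP.≤-Reasoning
  s = ℕ→ℚ (suc (suc m))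
  c = central (suc (suc m))
  K = ℕ→ℚ (4 ^ k)
  regroup : ∀ K s c → ℕ→ℚ 2 * (K * (ℕ→ℚ 2 * s * c)) ≡ s * (ℕ→ℚ 4 * K * c)
  regroup = solve 3 (λ K s c → con (ℕ→ℚ 2) :* (K :* (con (ℕ→ℚ 2) :* s :* c)) := s :* (con (ℕ→ℚ 4) :* K :* c)) refl

leaves≤size : ∀ t → leaves t ≤ size t
leaves≤size nil                     = z≤n
leaves≤size (node nil nil)          = s≤s z≤n
leaves≤size (node nil r@(node _ _)) = ℕP.m≤n⇒m≤1+n (leaves≤size r)
leaves≤size (node l@(node _ _) nil) = ℕP.m≤n⇒m≤1+n (ℕP.+-monoˡ-≤ 0 (leaves≤size l))
leaves≤size (node l@(node _ _) r@(node _ _)) = ℕP.m≤n⇒m≤1+n (ℕP.+-mono-≤ (leaves≤size l) (leaves≤size r))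

indicator-≡ᵇ≤<ᵇ : ∀ r k → indicator (r ≡ᵇ k) ≤ indicator (r <ᵇ suc k)
indicator-≡ᵇ≤<ᵇ zero    zero    = ℕP.≤-refl
indicator-≡ᵇ≤<ᵇ zero    (suc k) = z≤n
indicator-≡ᵇ≤<ᵇ (suc r) zero    = z≤n
indicator-≡ᵇ≤<ᵇ (suc r) (suc k) = indicator-≡ᵇ≤<ᵇ r k

rootPairs-≤ : ∀ k t → rootPairs k t ≤ size t *ℕ rank< (suc k) t
rootPairs-≤ k t = subst (rootPairs k t ≤_) (ℕP.*-comm (indicator (rank t <ᵇ suc k)) (size t))
  (ℕP.*-mono-≤ (indicator-≡ᵇ≤<ᵇ (rank t) k) (leaves≤size t))

f-bound : ∀ m k → f m k ≤ℚ ℕ→ℚ m * pLt m (suc k)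
f-bound m k = begin
  f m k                                                   ≡⟨ E-𝔼 m (rootPairs k) ⟩
  𝔼 m ⟦ rootPairs k ⟧                                     ≤⟨ 𝔼-mono m bound ⟩
  𝔼 m (λ t → ℕ→ℚ m * ⟦ rank< (suc k) ⟧ t) ≡⟨ 𝔼-*ˡ m (ℕ→ℚ m) ⟦ rank< (suc k) ⟧ ⟩
  ℕ→ℚ m * 𝔼 m ⟦ rank< (suc k) ⟧    ≡⟨ cong (ℕ→ℚ m *_) (E-𝔼 m (rank< (suc k))) ⟨
  ℕ→ℚ m * pLt m (suc k)                                   ∎
  where
  open ℚP.≤-Reasoning
  bound : ∀ t → size t ≡ m → ⟦ rootPairs k ⟧ t ≤ℚ ℕ→ℚ m * ⟦ rank< (suc k) ⟧ t
  bound t refl = subst (⟦ rootPairs k ⟧ t ≤ℚ_) (ℕ→ℚ-* (size t) _) (ℕ→ℚ-mono (rootPairs-≤ k t))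

κ : ℕ → ℕ
κ k = 2 *ℕ 4 ^ suc k

term-bound : ∀ k m → f (suc m) k * (+ 1 / (suc (suc m) *ℕ suc (suc (suc m))))
                   ≤ℚ ℕ→ℚ (κ k) * (central (suc m) - central (suc (suc m)))
term-bound k m = begin
  f (suc m) k * (+ 1 / (suc (suc m) *ℕ suc (suc (suc m))))
    ≤⟨ *-monoʳ-≤ _ (/-nonneg 1 (suc (suc m) *ℕ suc (suc (suc m)))) (f-bound (suc m) k) ⟩
  ℕ→ℚ (suc m) * P * (+ 1 / (suc (suc m) *ℕ suc (suc (suc m))))
    ≡⟨ cong (ℕ→ℚ (suc m) * P *_) (1/-* (suc (suc m)) (suc (suc (suc m)))) ⟩
  ℕ→ℚ (suc m) * P * (i₂ * i₃)
    ≡⟨ regroup (ℕ→ℚ (suc m)) P i₂ i₃ ⟩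
  P * (ℕ→ℚ (suc m) * i₃) * i₂
    ≤⟨ *-monoʳ-≤ i₂ (/-nonneg 1 (suc (suc m))) (*-monoˡ-≤ P (E-nonneg (suc m) (rank< (suc k))) s/s″≤1) ⟩
  P * 1ℚ * i₂
    ≡⟨ cong (_* i₂) (ℚP.*-identityʳ P) ⟩
  P * i₂
    ≤⟨ *-monoʳ-≤ i₂ (/-nonneg 1 (suc (suc m))) (pLt-bound (suc k) m) ⟩
  ℕ→ℚ (4 ^ suc k) * central (suc m) * i₂
    ≡⟨ ℚP.*-assoc (ℕ→ℚ (4 ^ suc k)) _ _ ⟩
  ℕ→ℚ (4 ^ suc k) * (central (suc m) * i₂)
    ≡⟨ cong (ℕ→ℚ (4 ^ suc k) *_) (central-telescope (suc m)) ⟩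
  ℕ→ℚ (4 ^ suc k) * (ℕ→ℚ 2 * δ)
    ≡⟨ ℚP.*-assoc (ℕ→ℚ (4 ^ suc k)) (ℕ→ℚ 2) δ ⟨
  ℕ→ℚ (4 ^ suc k) * ℕ→ℚ 2 * δ
    ≡⟨ cong (_* δ) (trans (ℚP.*-comm (ℕ→ℚ (4 ^ suc k)) (ℕ→ℚ 2)) (sym (ℕ→ℚ-* 2 (4 ^ suc k)))) ⟩
  ℕ→ℚ (κ k) * δ ∎
  where
  open ℚP.≤-Reasoning
  P = pLt (suc m) (suc k)
  i₂ = + 1 / suc (suc m)
  i₃ = + 1 / suc (suc (suc m))
  δ = central (suc m) - central (suc (suc m))
  regroup : ∀ s p a b → s * p * (a * b) ≡ p * (s * b) * a
  regroup = solve 4 (λ s p a b → s :* p :* (a :* b) := p :* (s :* b) :* a) refl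
  s/s″≤1 : ℕ→ℚ (suc m) * i₃ ≤ℚ 1ℚ
  s/s″≤1 = ℚP.≤-trans (*-monoʳ-≤ i₃ (/-nonneg 1 (suc (suc (suc m)))) (ℕ→ℚ-mono (ℕP.m≤n+m (suc m) 2)))
                      (ℚP.≤-reflexive (*-1/ (suc (suc (suc m)))))

S : ℕ → ℕ → ℚ
S k n = Σ1 n (λ m → f m k * (+ 1 / (suc m *ℕ suc (suc m))))

term : ℕ → ℕ → ℚ
term k m = f (suc m) k * (+ 1 / (suc (suc m) *ℕ suc (suc (suc m))))

term-nonneg : ∀ k m → 0ℚ ≤ℚ term k m
term-nonneg k m = *-nonneg (E-nonneg (suc m) (rootPairs k)) (/-nonneg 1 (suc (suc m) *ℕ suc (suc (suc m))))

S-∑< : ∀ k n → S k n ≡ ∑< n (term k)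
S-∑< k n = Σ1-∑< n (λ m → f m k * (+ 1 / (suc m *ℕ suc (suc m))))

S-split : ∀ k N d → S k (N +ℕ d) ≡ S k N + ∑< d (λ i → term k (N +ℕ i))
S-split k N d = trans (S-∑< k (N +ℕ d)) (trans (∑<-split N d (term k))
                        (cong (_+ ∑< d (λ i → term k (N +ℕ i))) (sym (S-∑< k N))))

S-tail : ∀ k N d → S k N ≤ℚ S k (N +ℕ d) × S k (N +ℕ d) ≤ℚ S k N + ℕ→ℚ (κ k) * central N
S-tail k N d =
  subst (S k N ≤ℚ_) (sym (S-split k N d)) (p≤p+q tail-nonneg) ,
  subst (_≤ℚ S k N + K * central N) (sym (S-split k N d)) (ℚP.+-monoʳ-≤ (S k N) (begin
    ∑< d (λ i → term k (N +ℕ i))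
      ≤⟨ ∑<-telescope (λ i → term k (N +ℕ i)) u K shifted-bound d ⟩
    K * (u 0 - u d)
      ≤⟨ *-monoˡ-≤ K (ℕ→ℚ-nonneg (κ k)) (p-q≤p (central-nonneg (suc (N +ℕ d)))) ⟩
    K * u 0
      ≤⟨ *-monoˡ-≤ K (ℕ→ℚ-nonneg (κ k)) (central-anti (ℕP.m≤n⇒m≤1+n (ℕP.m≤m+n N 0))) ⟩
    K * central N ∎))
  where
  open ℚP.≤-Reasoning
  K = ℕ→ℚ (κ k)
  u : ℕ → ℚ
  u i = central (suc (N +ℕ i))
  tail-nonneg : 0ℚ ≤ℚ ∑< d (λ i → term k (N +ℕ i))
  tail-nonneg = ∑<-nonneg d (λ i → term k (N +ℕ i)) (λ i → term-nonneg k (N +ℕ i))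
  shifted-bound : ∀ i → term k (N +ℕ i) ≤ℚ K * (u i - u (suc i))
  shifted-bound i = subst (λ x → term k (N +ℕ i) ≤ℚ K * (u i - central (suc x))) (sym (ℕP.+-suc N i))
                          (term-bound k (N +ℕ i))

S-close : ∀ k {N n} → N ≤ n → S k N ≤ℚ S k n × S k n ≤ℚ S k N + ℕ→ℚ (κ k) * central N
S-close k {N} N≤n = subst (λ n → S k N ≤ℚ S k n × S k n ≤ℚ S k N + ℕ→ℚ (κ k) * central N)
                          (sym (proj₂ (≤⇒∃+ N≤n))) (S-tail k N (proj₁ (≤⇒∃+ N≤n)))

S-nonneg : ∀ k n → 0ℚ ≤ℚ S k n
S-nonneg k n = subst (0ℚ ≤ℚ_) (sym (S-∑< k n)) (∑<-nonneg n (term k) (term-nonneg k))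

S-bounded : ∀ k n → S k n ≤ℚ ℕ→ℚ (κ k)
S-bounded k n = ℚP.≤-trans (proj₂ (S-close k (z≤n {n})))
                           (ℚP.≤-reflexive (trans (ℚP.+-identityˡ _) (ℚP.*-identityʳ _)))

ΣF-closed : ∀ k n → Σ1 n (λ m → F m k) ≡ ℕ→ℚ (suc n) * ℕ→ℚ (suc (suc n)) * S k n

F-closed : ∀ k n → F (suc n) k ≡ ℕ→ℚ 2 * ℕ→ℚ (suc (suc n)) * S k n + f (suc n) k
F-closed k n = *-cancelˡ-suc n (begin
  a * F (suc n) k                            ≡⟨ F-recurrence k n ⟩
  ℕ→ℚ 2 * Σ1 n (λ m → F m k) + a * f (suc n) k ≡⟨ cong (λ x → ℕ→ℚ 2 * x + a * f (suc n) k) (ΣF-closed k n) ⟩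
  ℕ→ℚ 2 * (a * b * S k n) + a * f (suc n) k  ≡⟨ regroup (ℕ→ℚ 2) a b (S k n) (f (suc n) k) ⟩
  a * (ℕ→ℚ 2 * b * S k n + f (suc n) k)      ∎)
  where
  open ≡-Reasoning
  a = ℕ→ℚ (suc n)
  b = ℕ→ℚ (suc (suc n))
  regroup : ∀ t a b s g → t * (a * b * s) + a * g ≡ a * (t * b * s + g)
  regroup = solve 5 (λ t a b s g → t :* (a :* b :* s) :+ a :* g := a :* (t :* b :* s :+ g)) refl

ΣF-closed k zero    = refl
ΣF-closed k (suc n) = begin
  Σ1 (suc n) (λ m → F m k)
    ≡⟨ Σ1-snoc n (λ m → F m k) ⟩
  Σ1 n (λ m → F m k) + F (suc n) k
    ≡⟨ cong₂ _+_ (ΣF-closed k n) (F-closed k n) ⟩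
  a * b * S k n + (ℕ→ℚ 2 * b * S k n + g)
    ≡⟨ cong (λ y → a * y * S k n + (ℕ→ℚ 2 * y * S k n + g)) b≡ ⟩
  a * (a + 1ℚ) * S k n + (ℕ→ℚ 2 * (a + 1ℚ) * S k n + g)
    ≡⟨ regroup a (S k n) g ⟩
  (a + 1ℚ) * (a + 1ℚ + 1ℚ) * S k n + g
    ≡⟨ cong₂ (λ y z → y * z * S k n + g) (sym b≡) (sym c≡) ⟩
  b * c * S k n + g
    ≡⟨ cong (_+_ (b * c * S k n)) g≡ ⟨
  b * c * S k n + b * c * (g * I)
    ≡⟨ ℚP.*-distribˡ-+ (b * c) (S k n) (g * I) ⟨
  b * c * (S k n + g * I)
    ≡⟨ cong (b * c *_) (Σ1-snoc n (λ m → f m k * (+ 1 / (suc m *ℕ suc (suc m))))) ⟨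
  b * c * S k (suc n) ∎
  where
  open ≡-Reasoning
  a = ℕ→ℚ (suc n)
  b = ℕ→ℚ (suc (suc n))
  c = ℕ→ℚ (suc (suc (suc n)))
  g = f (suc n) k
  I = + 1 / (suc (suc n) *ℕ suc (suc (suc n)))
  b≡ : b ≡ a + 1ℚ
  b≡ = ℕ→ℚ-suc (suc n)
  c≡ : c ≡ a + 1ℚ + 1ℚ
  c≡ = trans (ℕ→ℚ-suc (suc (suc n))) (cong (_+ 1ℚ) b≡)
  g≡ : b * c * (g * I) ≡ g
  g≡ = trans (cong (_* (g * I)) (sym (ℕ→ℚ-* (suc (suc n)) (suc (suc (suc n))))))
             (*-cancel-1/ (suc (suc n) *ℕ suc (suc (suc n))) g)
  regroup : ∀ a s g → a * (a + 1ℚ) * s + (ℕ→ℚ 2 * (a + 1ℚ) * s + g) ≡ (a + 1ℚ) * (a + 1ℚ + 1ℚ) * s + g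
  regroup = solve 3 (λ a s g → a :* (a :+ con 1ℚ) :* s :+ (con (ℕ→ℚ 2) :* (a :+ con 1ℚ) :* s :+ g)
                             := (a :+ con 1ℚ) :* (a :+ con 1ℚ :+ con 1ℚ) :* s :+ g) refl

F-split : ∀ k n M → F (suc n) k * (+ 1 / suc n) - ℕ→ℚ 2 * S k M
        ≡ f (suc n) k * (+ 1 / suc n) + ℕ→ℚ 2 * S k n * (+ 1 / suc n) + ℕ→ℚ 2 * (S k n - S k M)
F-split k n M = begin
  F (suc n) k * i - ℕ→ℚ 2 * S k M
    ≡⟨ cong (λ x → x * i - ℕ→ℚ 2 * S k M) (F-closed k n) ⟩
  (ℕ→ℚ 2 * ℕ→ℚ (suc (suc n)) * S k n + f (suc n) k) * i - ℕ→ℚ 2 * S k M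
    ≡⟨ cong (λ x → (ℕ→ℚ 2 * x * S k n + f (suc n) k) * i - ℕ→ℚ 2 * S k M) (ℕ→ℚ-suc (suc n)) ⟩
  (ℕ→ℚ 2 * (s + 1ℚ) * S k n + f (suc n) k) * i - ℕ→ℚ 2 * S k M
    ≡⟨ regroup s i (S k n) (S k M) (f (suc n) k) ⟩
  f (suc n) k * i + ℕ→ℚ 2 * S k n * i + ℕ→ℚ 2 * (S k n * (s * i) - S k M)
    ≡⟨ cong (λ x → f (suc n) k * i + ℕ→ℚ 2 * S k n * i + ℕ→ℚ 2 * (S k n * x - S k M)) (*-1/ (suc n)) ⟩
  f (suc n) k * i + ℕ→ℚ 2 * S k n * i + ℕ→ℚ 2 * (S k n * 1ℚ - S k M)
    ≡⟨ cong (λ x → f (suc n) k * i + ℕ→ℚ 2 * S k n * i + ℕ→ℚ 2 * (x - S k M)) (ℚP.*-identityʳ (S k n)) ⟩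
  f (suc n) k * i + ℕ→ℚ 2 * S k n * i + ℕ→ℚ 2 * (S k n - S k M) ∎
  where
  open ≡-Reasoning
  s = ℕ→ℚ (suc n)
  i = + 1 / suc n
  regroup : ∀ s i x y g → (ℕ→ℚ 2 * (s + 1ℚ) * x + g) * i - ℕ→ℚ 2 * y
                        ≡ g * i + ℕ→ℚ 2 * x * i + ℕ→ℚ 2 * (x * (s * i) - y)
  regroup = solve 5 (λ s i x y g → (con (ℕ→ℚ 2) :* (s :+ con 1ℚ) :* x :+ g) :* i :- con (ℕ→ℚ 2) :* y
                                 := g :* i :+ con (ℕ→ℚ 2) :* x :* i :+ con (ℕ→ℚ 2) :* (x :* (s :* i) :- y)) refl

f/n-bound : ∀ k {N n} → N ≤ n → f (suc n) k * (+ 1 / suc n) ≤ℚ ℕ→ℚ (κ k) * central N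
f/n-bound k {N} {n} N≤n = begin
  f (suc n) k * (+ 1 / suc n)
    ≤⟨ *-monoʳ-≤ (+ 1 / suc n) (/-nonneg 1 (suc n)) (f-bound (suc n) k) ⟩
  ℕ→ℚ (suc n) * P * (+ 1 / suc n)
    ≡⟨ cong (_* (+ 1 / suc n)) (ℚP.*-comm (ℕ→ℚ (suc n)) P) ⟩
  P * ℕ→ℚ (suc n) * (+ 1 / suc n)
    ≡⟨ ℚP.*-assoc P (ℕ→ℚ (suc n)) (+ 1 / suc n) ⟩
  P * (ℕ→ℚ (suc n) * (+ 1 / suc n))
    ≡⟨ trans (cong (P *_) (*-1/ (suc n))) (ℚP.*-identityʳ P) ⟩
  P
    ≤⟨ pLt-bound (suc k) n ⟩
  ℕ→ℚ (4 ^ suc k) * central (suc n)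
    ≤⟨ *-monoʳ-≤ (central (suc n)) (central-nonneg (suc n)) (ℕ→ℚ-mono (ℕP.m≤m+n (4 ^ suc k) _)) ⟩
  ℕ→ℚ (κ k) * central (suc n)
    ≤⟨ *-monoˡ-≤ (ℕ→ℚ (κ k)) (ℕ→ℚ-nonneg (κ k)) (central-anti (ℕP.m≤n⇒m≤1+n N≤n)) ⟩
  ℕ→ℚ (κ k) * central N ∎
  where
  open ℚP.≤-Reasoning
  P = pLt (suc n) (suc k)

S/n-bound : ∀ k {N n} → N ≤ n → S k n * (+ 1 / suc n) ≤ℚ ℕ→ℚ (κ k) * central N
S/n-bound k {N} {n} N≤n = ℚP.≤-trans (*-monoʳ-≤ (+ 1 / suc n) (/-nonneg 1 (suc n)) (S-bounded k n))
  (*-monoˡ-≤ (ℕ→ℚ (κ k)) (ℕ→ℚ-nonneg (κ k)) (ℚP.≤-trans (1/suc≤central n) (central-anti N≤n)))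

S-oscillation : ∀ k {N n M} → N ≤ n → N ≤ M →
  - (ℕ→ℚ (κ k) * central N) ≤ℚ S k n - S k M × S k n - S k M ≤ℚ ℕ→ℚ (κ k) * central N
S-oscillation k {N} {n} {M} N≤n N≤M =
  (begin
    - Kγ
      ≡⟨ cancel′ (S k N) Kγ ⟨
    S k N - (S k N + Kγ)
      ≤⟨ ℚP.+-mono-≤ (proj₁ (S-close k N≤n)) (ℚP.neg-antimono-≤ (proj₂ (S-close k N≤M))) ⟩
    S k n - S k M ∎) ,
  (begin
    S k n - S k M
      ≤⟨ ℚP.+-mono-≤ (proj₂ (S-close k N≤n)) (ℚP.neg-antimono-≤ (proj₁ (S-close k N≤M))) ⟩
    S k N + Kγ - S k N
      ≡⟨ cancel (S k N) Kγ ⟩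
    Kγ ∎)
  where
  open ℚP.≤-Reasoning
  Kγ = ℕ→ℚ (κ k) * central N
  cancel : ∀ x y → x + y - x ≡ y
  cancel = solve 2 (λ x y → x :+ y :- x := y) refl
  cancel′ : ∀ x y → x - (x + y) ≡ - y
  cancel′ = solve 2 (λ x y → x :- (x :+ y) := :- y) refl

F-estimate : ∀ k {N n M} → N ≤ n → N ≤ M →
  ∣ F (suc n) k * (+ 1 / suc n) - ℕ→ℚ 2 * S k M ∣ ≤ℚ ℕ→ℚ 5 * (ℕ→ℚ (κ k) * central N)
F-estimate k {N} {n} {M} N≤n N≤M =
  -q≤p≤q⇒∣p∣≤q (subst (- (ℕ→ℚ 5 * Kγ) ≤ℚ_) (sym (F-split k n M)) lower)
               (subst (_≤ℚ ℕ→ℚ 5 * Kγ) (sym (F-split k n M)) upper)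
  where
  open ℚP.≤-Reasoning
  Kγ = ℕ→ℚ (κ k) * central N
  i = + 1 / suc n
  0≤2 = ℕ→ℚ-nonneg 2
  upper : f (suc n) k * i + ℕ→ℚ 2 * S k n * i + ℕ→ℚ 2 * (S k n - S k M) ≤ℚ ℕ→ℚ 5 * Kγ
  upper = begin
    f (suc n) k * i + ℕ→ℚ 2 * S k n * i + ℕ→ℚ 2 * (S k n - S k M)
      ≤⟨ ℚP.+-mono-≤ (ℚP.+-mono-≤ (f/n-bound k N≤n)
                                  (ℚP.≤-trans (ℚP.≤-reflexive (ℚP.*-assoc (ℕ→ℚ 2) (S k n) i))
                                              (*-monoˡ-≤ (ℕ→ℚ 2) 0≤2 (S/n-bound k N≤n))))
                     (*-monoˡ-≤ (ℕ→ℚ 2) 0≤2 (proj₂ (S-oscillation k N≤n N≤M))) ⟩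
    Kγ + ℕ→ℚ 2 * Kγ + ℕ→ℚ 2 * Kγ
      ≡⟨ five Kγ ⟩
    ℕ→ℚ 5 * Kγ ∎
    where
    five : ∀ x → x + ℕ→ℚ 2 * x + ℕ→ℚ 2 * x ≡ ℕ→ℚ 5 * x
    five = solve 1 (λ x → x :+ con (ℕ→ℚ 2) :* x :+ con (ℕ→ℚ 2) :* x := con (ℕ→ℚ 5) :* x) refl
  lower : - (ℕ→ℚ 5 * Kγ) ≤ℚ f (suc n) k * i + ℕ→ℚ 2 * S k n * i + ℕ→ℚ 2 * (S k n - S k M)
  lower = begin
    - (ℕ→ℚ 5 * Kγ)
      ≤⟨ ℚP.neg-antimono-≤ (*-monoʳ-≤ Kγ (*-nonneg (ℕ→ℚ-nonneg (κ k)) (central-nonneg N))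
                                         (ℕ→ℚ-mono {2} {5} (s≤s (s≤s z≤n)))) ⟩
    - (ℕ→ℚ 2 * Kγ)
      ≡⟨ ℚP.neg-distribʳ-* (ℕ→ℚ 2) Kγ ⟩
    ℕ→ℚ 2 * - Kγ
      ≤⟨ *-monoˡ-≤ (ℕ→ℚ 2) 0≤2 (proj₁ (S-oscillation k N≤n N≤M)) ⟩
    ℕ→ℚ 2 * (S k n - S k M)
      ≤⟨ p≤q+p (+-nonneg (*-nonneg (E-nonneg (suc n) (rootPairs k)) (/-nonneg 1 (suc n)))
                         (*-nonneg (*-nonneg 0≤2 (S-nonneg k n)) (/-nonneg 1 (suc n)))) ⟩
    f (suc n) k * i + ℕ→ℚ 2 * S k n * i + ℕ→ℚ 2 * (S k n - S k M) ∎

central-small : ∀ L {ε} → 0ℚ <ℚ ε → ∃[ N ] ℕ→ℚ L * central N ≤ℚ ε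
central-small L {ε} 0<ε with q , 1≤εq ← archimedean ε 0<ε =
  N , ℚP.*-cancelʳ-≤-pos (ℕ→ℚ (suc q)) {{ℕ→ℚ-pos q}} (begin
    ℕ→ℚ L * central N * ℕ→ℚ (suc q)   ≡⟨ regroup (ℕ→ℚ L) (central N) (ℕ→ℚ (suc q)) ⟩
    ℕ→ℚ L * ℕ→ℚ (suc q) * central N   ≡⟨ cong (_* central N) (ℕ→ℚ-* L (suc q)) ⟨
    y                                 ≤⟨ p*p≤1⇒p≤1 y²≤1 ⟩
    1ℚ                                ≤⟨ 1≤εq ⟩
    ε * ℕ→ℚ (suc q)                   ∎)
  where
  open ℚP.≤-Reasoning
  L′ = L *ℕ suc q
  N = L′ *ℕ L′
  c = central N
  y = ℕ→ℚ L′ * c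
  regroup : ∀ l c s → l * c * s ≡ l * s * c
  regroup = solve 3 (λ l c s → l :* c :* s := l :* s :* c) refl
  y²≤1 : y * y ≤ℚ 1ℚ
  y²≤1 = begin
    ℕ→ℚ L′ * c * (ℕ→ℚ L′ * c)         ≡⟨ square (ℕ→ℚ L′) c ⟩
    ℕ→ℚ L′ * ℕ→ℚ L′ * (c * c)         ≡⟨ cong (_* (c * c)) (ℕ→ℚ-* L′ L′) ⟨
    ℕ→ℚ N * (c * c)                   ≤⟨ *-monoʳ-≤ (c * c) (*-nonneg (central-nonneg N) (central-nonneg N))
                                                    (ℕ→ℚ-mono (ℕP.m≤n⇒m≤1+n (ℕP.m≤m+n N (N +ℕ 0)))) ⟩
    ℕ→ℚ (suc (2 *ℕ N)) * (c * c)       ≡⟨ ℚP.*-comm _ (c * c) ⟩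
    c * c * ℕ→ℚ (suc (2 *ℕ N))         ≤⟨ central-sq N ⟩
    1ℚ                                ∎
    where
    square : ∀ l c → l * c * (l * c) ≡ l * l * (c * c)
    square = solve 2 (λ l c → l :* c :* (l :* c) := l :* l :* (c :* c)) refl

F-limit : ∀ k (ε : ℚ) → 0ℚ <ℚ ε → ∃[ N ] ((n M : ℕ) → N ≤ n → N ≤ M →
  ∣ F (suc n) k * (+ 1 / suc n) - ℕ→ℚ 2 * Σ1 M (λ m → f m k * (+ 1 / (suc m *ℕ suc (suc m)))) ∣ ≤ℚ ε)
F-limit k ε 0<ε = N , λ n M N≤n N≤M → ℚP.≤-trans (F-estimate k N≤n N≤M) (subst (_≤ℚ ε) assoc small)
  where
  N = proj₁ (central-small (5 *ℕ κ k) 0<ε)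
  small = proj₂ (central-small (5 *ℕ κ k) 0<ε)
  assoc : ℕ→ℚ (5 *ℕ κ k) * central N ≡ ℕ→ℚ 5 * (ℕ→ℚ (κ k) * central N)
  assoc = trans (cong (_* central N) (ℕ→ℚ-* 5 (κ k))) (ℚP.*-assoc (ℕ→ℚ 5) (ℕ→ℚ (κ k)) (central N))

lemma4p1 : (k : ℕ) →
    -- [x^n] A_k' = [x^n] (2/(1-x)) A_k + [x^n] B_k'
    ((n : ℕ) → ℕ→ℚ (suc n) * F (suc n) k
               ≡ ℕ→ℚ 2 * Σ1 n (λ m → F m k) + ℕ→ℚ (suc n) * f (suc n) k)
    -- [x^n] B_{>k}' = [x^n] 2 (1/(1-x) - B_{≤k-1}) B_{>k-1}
    × ((n : ℕ) → ℕ→ℚ (suc n) * fGe (suc n) (suc k)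
               ≡ ℕ→ℚ 2 * (Σ1 n (λ m → fGe m k)
                          - Σ1 (n ∸ 1) (λ i → pLt i k * fGe (n ∸ i) k)))
    -- B_{>-1} = Σ E[L_n] x^n = (x-1)/3 + 1/(3(1-x)^2), coefficientwise
    × ((n : ℕ) → fGe (suc n) 0 ≡ EL (suc n))
    × (EL 1 ≡ ℕ→ℚ 1)
    × ((n : ℕ) → EL (suc (suc n)) ≡ + (suc (suc (suc n))) / 3)
    -- F_{n,k}/n → 2 ∫_0^1 (1-x) B_k(x) dx = 2 Σ_{m≥1} f_{m,k} / ((m+1)(m+2))
    × ((ε : ℚ) → 0ℚ <ℚ ε → ∃[ N ] ((n M : ℕ) → N ≤ n → N ≤ M →
         ∣ F (suc n) k * (+ 1 / suc n)
           - ℕ→ℚ 2 * Σ1 M (λ m → f m k * (+ 1 / (suc m *ℕ suc (suc m)))) ∣ ≤ℚ ε))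
lemma4p1 k =
  F-recurrence k ,
  fGe-recurrence k ,
  (λ n → fGe-zero (suc n)) ,
  refl ,
  (λ n → trans (EL-closed n) (sym (/≡*1/ (3 +ℕ n) 3))) ,
  F-limit k
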